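{- Let $b\ge2$ and $0\le k<b$, and let $\mathbf k$ be the constant configuration $\mathbf k(v)=k$ on the $b$-ary tree $\mathbb T_b$. For a positive integer $t$ let $z_t$ be the number of trailing zeros in the base-$b$ expansion of $t$ and $\ell_t\in\{1,\dots,b-1\}$ its last nonzero digit (so $t\equiv\ell_t b^{z_t}\pmod{b^{z_t+1}}$). Then $$e(\mathbb T_b,\mathbf k)=\begin{cases}1\,0^{z_1}\,1\,0^{z_2}\,1\,0^{z_3}\cdots,&k=0,\\ 1\,0^{\mathbf 1[\ell_1=b-k]}\,1\,0^{\mathbf 1[\ell_2=b-k]}\,1\,0^{\mathbf 1[\ell_3=b-k]}\cdots,&0<k<b,\end{cases}$$ where $0^m$ denotes a string of $m$ zeros and $\mathbf 1[\cdot]$ is the indicator.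
   Context: The $b$-ary tree $\mathbb T_b$ is the rooted tree whose root $\rho$ has exactly one child and in which every non-root vertex has exactly $b$ children. For a non-root $v$, $v^{(0)}$ is its parent and $v^{(1)},\dots,v^{(b)}$ its children, labelled so that the fixed cyclic order of neighbours is $v^{(0)},\dots,v^{(b)}$. A rotor configuration assigns to each non-root $v$ a value $r(v)\in\{0,\dots,b\}$, meaning the rotor at $v$ points to $v^{(r(v))}$; the rotor at $\rho$ always points to its only child. Rotor walk: at each step the rotor at the particle's current vertex is advanced to the next neighbour in the cyclic order, and the particle moves there. Particles are started one after another at $\rho$: each performs rotor walk until it first returns to $\rho$, or else never returns (it escapes to infinity); the next particle starts with the rotors left by the previous ones. The escape sequence $e(T,r)=(e_1,e_2,\dots)$ has $e_n=1$ if particle $n$ escapes and $0$ otherwise. -}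

module Defs where

open import Data.Nat using (ℕ; zero; suc; _+_; _∸_; _≤_; _<_; _≟_; NonZero)
open import Data.Nat.DivMod using (_%_; _/_; m%n<n)
open import Data.Nat.Properties using (m<n⇒m<1+n)
open import Data.Fin as Fin using (Fin; toℕ; fromℕ<)
open import Data.List using (List; []; _∷_; _++_; replicate)
open import Data.List.Properties using (≡-dec)
open import Data.Product using (Σ; _×_; _,_; proj₁; proj₂; ∃)
open import Data.Empty using (⊥)
open import Relation.Nullary using (¬_; yes; no)
open import Relation.Binary.PropositionalEquality using (_≡_; _≢_; _≗_)
open import Function using (id)

-- The b-ary tree T_b.
-- ρ is the root; node w is a non-root vertex, where w is the list of
-- child indices read from the vertex upwards: node [] is the unique
-- child of ρ, node (i ∷ w) is child number (i+1) of node w.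

data Vertex (b : ℕ) : Set where
  ρ    : Vertex b
  node : List (Fin b) → Vertex b

parentOf : ∀ {b} → List (Fin b) → Vertex b
parentOf []      = ρ
parentOf (_ ∷ w) = node w

neighbour : ∀ {b} → List (Fin b) → Fin (suc b) → Vertex b
neighbour w Fin.zero    = parentOf w
neighbour w (Fin.suc i) = node (i ∷ w)

-- rotor configuration on non-root vertices (root rotor is fixed)
Config : ℕ → Set
Config b = List (Fin b) → Fin (suc b)

next : ∀ {b} → Fin (suc b) → Fin (suc b)
next {b} r = fromℕ< (m%n<n (suc (toℕ r)) (suc b))

update : ∀ {b} → Config b → List (Fin b) → Fin (suc b) → Config b
update c w r u with ≡-dec Fin._≟_ u w
... | yes _ = r
... | no  _ = c u

State : ℕ → Set
State b = Vertex b × Config b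

step : ∀ {b} → State b → State b
step (ρ , c)      = node [] , c
step (node w , c) = neighbour w (next (c w)) , update c w (next (c w))

run : ∀ {b} → Config b → ℕ → State b
run c zero    = ρ , c
run c (suc m) = step (run c m)

pos : ∀ {b} → Config b → ℕ → Vertex b
pos c m = proj₁ (run c m)

cfg : ∀ {b} → Config b → ℕ → Config b
cfg c m = proj₂ (run c m)

Returns : ∀ {b} → Config b → Config b → Set
Returns c c' = Σ ℕ λ m → (1 ≤ m) × (pos c m ≡ ρ)
  × (∀ m' → 1 ≤ m' → m' < m → pos c m' ≢ ρ) × (cfg c m ≗ c')

Escapes : ∀ {b} → Config b → Config b → Set
Escapes c c' = (∀ m → 1 ≤ m → pos c m ≢ ρ)
  × (∀ v → ∃ λ m₀ → ∀ m → m₀ ≤ m → cfg c m v ≡ c' v)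

Outcome : ∀ {b} → Config b → ℕ → Config b → Set
Outcome c zero          c' = Returns c c'
Outcome c (suc zero)    c' = Escapes c c'
Outcome c (suc (suc _)) c' = ⊥

-- e is the escape sequence of (T_b, c): e n is e_{n+1} (particle n+1),
-- C n is the configuration before particle n+1 starts.
IsEscapeSeq : ∀ {b} → Config b → (ℕ → ℕ) → Set
IsEscapeSeq {b} c e = Σ (ℕ → Config b) λ C →
  (C 0 ≗ c) × (∀ n → Outcome (C n) (e n) (C (suc n)))

constCfg : (b k : ℕ) → k < b → Config b
constCfg b k k<b = λ _ → fromℕ< (m<n⇒m<1+n k<b)

tzF : ℕ → (b t : ℕ) .{{_ : NonZero b}} → ℕ
tzF zero    b t = 0
tzF (suc f) b zero = 0
tzF (suc f) b (suc t) with (suc t) % b ≟ 0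
... | yes _ = suc (tzF f b (suc t / b))
... | no  _ = 0

trailingZeros : (b t : ℕ) .{{_ : NonZero b}} → ℕ
trailingZeros b t = tzF t b t

lnzF : ℕ → (b t : ℕ) .{{_ : NonZero b}} → ℕ
lnzF zero    b t = t % b
lnzF (suc f) b zero = 0
lnzF (suc f) b (suc t) with (suc t) % b ≟ 0
... | yes _ = lnzF f b (suc t / b)
... | no  _ = (suc t) % b

lastNonzeroDigit : (b t : ℕ) .{{_ : NonZero b}} → ℕ
lastNonzeroDigit b t = lnzF t b t

blocks : (ℕ → ℕ) → ℕ → List ℕ
blocks m zero    = []
blocks m (suc N) = blocks m N ++ (1 ∷ replicate (m (suc N)) 0)

at : List ℕ → ℕ → ℕ
at []       _       = 0
at (x ∷ xs) zero    = x
at (x ∷ xs) (suc n) = at xs n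

-- 0-based: onesAndZeros m n is the (n+1)-st symbol
onesAndZeros : (ℕ → ℕ) → ℕ → ℕ
onesAndZeros m n = at (blocks m (suc n)) n

zeroRun : (b k : ℕ) .{{_ : NonZero b}} → ℕ → ℕ
zeroRun b zero    t = trailingZeros b t
zeroRun b (suc k) t with lastNonzeroDigit b t ≟ b ∸ suc k
... | yes _ = 1
... | no  _ = 0

escPattern : (b k : ℕ) .{{_ : NonZero b}} → ℕ → ℕ
escPattern b k = onesAndZeros (λ t → zeroRun b k t)

module Submission where

-- A non-root vertex that has been left P times has rotor (k + P) mod (b + 1). Its departures thus
-- come in blocks of b + 1: in block r the departure at offset b − k goes to the parent and the others
-- enter the b children, each of which has then received exactly r particles. All subtrees are copies
-- of the whole tree, so by strong induction on the number of particles the r-th particle entering any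
-- non-root vertex escapes iff ε_r = 1, where ε is the claimed sequence: if the children follow ε,
-- recording how the particles entering a vertex end (0 to the parent, 1 escaping through a child)
-- yields σ(ε), block r contributing σ(ε_r) with σ(1) = 1^(b−k) 0 1^k and σ(0) = 0; and σ(ε) = ε,
-- since b N + 1, …, b N + b end in the digits 1, …, b − 1, 0, the last one carrying the digits of
-- N + 1. The base case ε_0 = 1 is the first particle in a fresh subtree, which runs down the children
-- numbered k forever. Uniqueness is determinism of rotor walk.

open import Defs
open import Data.Nat
  using (ℕ; zero; suc; _+_; _*_; _∸_; _≤_; _<_; _≤′_; ≤′-refl; ≤′-step; _≟_; _≤?_; _<?_; NonZero; z≤n; s≤s; pred; >-nonZero)
open import Data.Nat.Properties
open import Data.Nat.DivMod
  using (_%_; _/_; m%n<n; m%n%n≡m%n; %-distribˡ-+; [m+n]%n≡m%n; [m+kn]%n≡m%n; m<n⇒m%n≡m; n%n≡0; m*n%n≡0;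
         m≡m%n+[m/n]*n; m/n<m; m<n⇒m/n≡0; m*n/n≡m; m/n*n≤m; +-distrib-/-∣ʳ)
open import Data.Nat.Divisibility using (divides-refl)
open import Data.Nat.GeneralisedArithmetic using (fold; fold-+)
open import Data.Nat.Induction using (<-rec)
open import Data.Nat.Tactic.RingSolver using (solve-∀)
open import Data.Fin as Fin using (Fin; toℕ; fromℕ<)
open import Data.Fin.Properties using (toℕ-fromℕ<; toℕ-injective; toℕ<n)
open import Data.List using (List; []; _∷_; _++_; _∷ʳ_; [_]; replicate; length; applyUpTo; concatMap; map; concat; reverse)
open import Data.List.Properties
  using (++-assoc; ++-identityʳ; ++-cancelʳ; length-++; length-replicate; length-applyUpTo; applyUpTo-∷ʳ; map-++; concat-++;
         ∷-injectiveˡ; ∷-injectiveʳ; ∷ʳ-injectiveʳ; unfold-reverse; reverse-++; reverse-involutive; ≡-dec)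
open import Data.List.Reverse using (reverseView; []; _∶_∶ʳ_)
open import Data.Product using (∃; _×_; _,_; proj₁; proj₂)
open import Data.Sum using (_⊎_; inj₁; inj₂)
open import Data.Empty using (⊥; ⊥-elim)
open import Function using (_∘_)
open import Relation.Nullary using (¬_; Dec; yes; no)
open import Relation.Binary.Definitions using (tri<; tri≈; tri>)
open import Relation.Binary.PropositionalEquality hiding ([_])

module ListFacts where

  private
    variable
      A B : Set

  replicate-∷ʳ : ∀ n (x : A) → replicate n x ∷ʳ x ≡ replicate (suc n) x
  replicate-∷ʳ zero    x = refl
  replicate-∷ʳ (suc n) x = cong (x ∷_) (replicate-∷ʳ n x)

  replicate-++-∷ : ∀ n (x : A) xs → replicate n x ++ x ∷ xs ≡ x ∷ replicate n x ++ xs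
  replicate-++-∷ zero    x xs = refl
  replicate-++-∷ (suc n) x xs = cong (x ∷_) (replicate-++-∷ n x xs)

  reverse-replicate : ∀ n (x : A) → reverse (replicate n x) ≡ replicate n x
  reverse-replicate zero    x = refl
  reverse-replicate (suc n) x =
    trans (unfold-reverse x (replicate n x)) (trans (cong (_∷ʳ x) (reverse-replicate n x)) (replicate-∷ʳ n x))

  concatMap-++ : ∀ (f : A → List B) xs ys → concatMap f (xs ++ ys) ≡ concatMap f xs ++ concatMap f ys
  concatMap-++ f xs ys = trans (cong concat (map-++ f xs ys)) (sym (concat-++ (map f xs) (map f ys)))

  infix 4 _⊑_
  _⊑_ : List A → List A → Set
  xs ⊑ ys = ∃ λ zs → xs ++ zs ≡ ys

  ⊑-refl : ∀ {xs : List A} → xs ⊑ xs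
  ⊑-refl = [] , ++-identityʳ _

  ⊑-++ : ∀ (xs ys : List A) → xs ⊑ xs ++ ys
  ⊑-++ xs ys = ys , refl

  ⊑-trans : ∀ {xs ys zs : List A} → xs ⊑ ys → ys ⊑ zs → xs ⊑ zs
  ⊑-trans {xs = xs} (us , refl) (vs , refl) = us ++ vs , sym (++-assoc xs us vs)

  ⊑-length : ∀ {xs ys : List A} → xs ⊑ ys → length xs ≤ length ys
  ⊑-length {xs = xs} (zs , refl) = subst (length xs ≤_) (sym (length-++ xs)) (m≤m+n _ _)

  concatMap-⊑ : ∀ (f : A → List B) {xs ys : List A} → xs ⊑ ys → concatMap f xs ⊑ concatMap f ys
  concatMap-⊑ f {xs = xs} (zs , refl) = concatMap f zs , sym (concatMap-++ f xs zs)

  ∷-⊑ : ∀ {x : A} {xs ys} → xs ⊑ ys → x ∷ xs ⊑ x ∷ ys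
  ∷-⊑ (zs , refl) = zs , refl

  ⊑-monotone : ∀ (f : ℕ → List A) → (∀ n → f n ⊑ f (suc n)) → ∀ {m n} → m ≤ n → f m ⊑ f n
  ⊑-monotone f f⊑f∘suc {m = m} m≤n = go (≤⇒≤′ m≤n)
    where
    go : ∀ {n} → m ≤′ n → f m ⊑ f n
    go ≤′-refl        = ⊑-refl
    go (≤′-step m≤n') = ⊑-trans (go m≤n') (f⊑f∘suc _)

  applyUpTo-⊑ : ∀ (f : ℕ → A) {m n} → m ≤ n → applyUpTo f m ⊑ applyUpTo f n
  applyUpTo-⊑ f {n = n} z≤n = applyUpTo f n , refl
  applyUpTo-⊑ f (s≤s m≤n) = ∷-⊑ (applyUpTo-⊑ (λ i → f (suc i)) m≤n)

  PrefixOf : List ℕ → (ℕ → ℕ) → Set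
  PrefixOf xs f = ∀ i → i < length xs → at xs i ≡ f i

  at-++ˡ : ∀ xs ys {i} → i < length xs → at (xs ++ ys) i ≡ at xs i
  at-++ˡ (x ∷ xs) ys {zero}  _         = refl
  at-++ˡ (x ∷ xs) ys {suc i} (s≤s i<n) = at-++ˡ xs ys i<n

  PrefixOf-⊑ : ∀ {xs ys f} → xs ⊑ ys → PrefixOf ys f → PrefixOf xs f
  PrefixOf-⊑ {xs} (zs , refl) ys≼f i i<n =
    trans (sym (at-++ˡ xs zs i<n)) (ys≼f i (<-≤-trans i<n (⊑-length {xs = xs} (zs , refl))))

  PrefixOf⇒applyUpTo : ∀ xs {f} → PrefixOf xs f → xs ≡ applyUpTo f (length xs)
  PrefixOf⇒applyUpTo []       _    = refl
  PrefixOf⇒applyUpTo (x ∷ xs) x≼f =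
    cong₂ _∷_ (x≼f 0 (s≤s z≤n)) (PrefixOf⇒applyUpTo xs (λ i i<n → x≼f (suc i) (s≤s i<n)))

module BlockSequence (m : ℕ → ℕ) where

  open ListFacts

  block : ℕ → List ℕ
  block t = 1 ∷ replicate (m t) 0

  blockRange : ℕ → ℕ → List ℕ
  blockRange n zero    = []
  blockRange n (suc d) = blockRange n d ++ block (suc (d + n))

  blocks-+ : ∀ n d → blocks m (d + n) ≡ blocks m n ++ blockRange n d
  blocks-+ n zero    = sym (++-identityʳ _)
  blocks-+ n (suc d) = trans (cong (_++ block (suc (d + n))) (blocks-+ n d))
                             (++-assoc (blocks m n) (blockRange n d) _)

  blocks-⊑ : ∀ {M N} → M ≤ N → blocks m M ⊑ blocks m N
  blocks-⊑ = ⊑-monotone (blocks m) (λ N → ⊑-++ (blocks m N) _)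

  length-blocks : ∀ N → N ≤ length (blocks m N)
  length-blocks zero    = z≤n
  length-blocks (suc N) = subst (suc N ≤_) (sym (length-++ (blocks m N)))
    (subst (suc N ≤_) (sym (+-suc _ _)) (s≤s (≤-trans (length-blocks N) (m≤m+n _ _))))

  -- Symbol i of the sequence is read off blocks m (suc i); both lists are prefixes of blocks m (N + suc i).
  blocks-PrefixOf : ∀ N → PrefixOf (blocks m N) (onesAndZeros m)
  blocks-PrefixOf N i i<n =
    trans (sym (at-++ˡ (blocks m N) _ i<n))
      (trans (cong (λ l → at l i) (proj₂ (blocks-⊑ (m≤m+n N (suc i)))))
        (trans (sym (cong (λ l → at l i) (proj₂ (blocks-⊑ (m≤n+m (suc i) N)))))
          (at-++ˡ (blocks m (suc i)) _ (length-blocks (suc i)))))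

module BaseExpansion (b : ℕ) .{{_ : NonZero b}} (1<b : 1 < b) where

  open ListFacts

  private
    0%b≡0 : 0 % b ≡ 0
    0%b≡0 = m<n⇒m%n≡m (<-trans (s≤s z≤n) 1<b)

    /b-fuel : ∀ {t f} → t ≤ f → suc t / b ≤ f
    /b-fuel {t} t≤f = ≤-pred (<-≤-trans (m/n<m (suc t) b 1<b) (s≤s t≤f))

    b*t%b≡0 : ∀ t → (b * t) % b ≡ 0
    b*t%b≡0 t = trans (cong (_% b) (*-comm b t)) (m*n%n≡0 t b)

    b*t/b≡t : ∀ t → (b * t) / b ≡ t
    b*t/b≡t t = trans (cong (_/ b) (*-comm b t)) (m*n/n≡m t b)

    t<b*t : ∀ t → 1 ≤ t → t < b * t
    t<b*t t@(suc _) _ = subst (t <_) (*-comm t b) (m<m*n t b 1<b)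

  tzF-fuel : ∀ f f' t → t ≤ f → t ≤ f' → tzF f b t ≡ tzF f' b t
  tzF-fuel zero    zero     zero    _ _ = refl
  tzF-fuel zero    (suc f') zero    _ _ = refl
  tzF-fuel (suc f) zero     zero    _ _ = refl
  tzF-fuel (suc f) (suc f') zero    _ _ = refl
  tzF-fuel (suc f) (suc f') (suc t) (s≤s t≤f) (s≤s t≤f') with suc t % b ≟ 0
  ... | yes _ = cong suc (tzF-fuel f f' (suc t / b) (/b-fuel t≤f) (/b-fuel t≤f'))
  ... | no  _ = refl

  lnzF-fuel : ∀ f f' t → t ≤ f → t ≤ f' → lnzF f b t ≡ lnzF f' b t
  lnzF-fuel zero    zero     zero    _ _ = refl
  lnzF-fuel zero    (suc f') zero    _ _ = 0%b≡0
  lnzF-fuel (suc f) zero     zero    _ _ = sym 0%b≡0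
  lnzF-fuel (suc f) (suc f') zero    _ _ = refl
  lnzF-fuel (suc f) (suc f') (suc t) (s≤s t≤f) (s≤s t≤f') with suc t % b ≟ 0
  ... | yes _ = lnzF-fuel f f' (suc t / b) (/b-fuel t≤f) (/b-fuel t≤f')
  ... | no  _ = refl

  trailingZeros-nonMultiple : ∀ t → t % b ≢ 0 → trailingZeros b t ≡ 0
  trailingZeros-nonMultiple zero    t%b≢0 = ⊥-elim (t%b≢0 0%b≡0)
  trailingZeros-nonMultiple (suc t) t%b≢0 with suc t % b ≟ 0
  ... | yes t%b≡0 = ⊥-elim (t%b≢0 t%b≡0)
  ... | no  _     = refl

  lastNonzeroDigit-nonMultiple : ∀ t → t % b ≢ 0 → lastNonzeroDigit b t ≡ t % b
  lastNonzeroDigit-nonMultiple zero    t%b≢0 = ⊥-elim (t%b≢0 0%b≡0)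
  lastNonzeroDigit-nonMultiple (suc t) t%b≢0 with suc t % b ≟ 0
  ... | yes t%b≡0 = ⊥-elim (t%b≢0 t%b≡0)
  ... | no  _     = refl

  trailingZeros-b* : ∀ t → 1 ≤ t → trailingZeros b (b * t) ≡ suc (trailingZeros b t)
  trailingZeros-b* t 1≤t = go (b * t) refl
    where
    go : ∀ u → u ≡ b * t → trailingZeros b u ≡ suc (trailingZeros b t)
    go zero    u≡bt = ⊥-elim (<-irrefl u≡bt (≤-<-trans z≤n (t<b*t t 1≤t)))
    go (suc u) u≡bt with suc u % b ≟ 0
    ... | yes _ = cong suc (trans (cong (λ z → tzF u b z) (trans (cong (_/ b) u≡bt) (b*t/b≡t t)))
                                  (tzF-fuel u t t (≤-pred (subst (t <_) (sym u≡bt) (t<b*t t 1≤t))) ≤-refl))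
    ... | no u%b≢0 = ⊥-elim (u%b≢0 (trans (cong (_% b) u≡bt) (b*t%b≡0 t)))

  lastNonzeroDigit-b* : ∀ t → 1 ≤ t → lastNonzeroDigit b (b * t) ≡ lastNonzeroDigit b t
  lastNonzeroDigit-b* t 1≤t = go (b * t) refl
    where
    go : ∀ u → u ≡ b * t → lastNonzeroDigit b u ≡ lastNonzeroDigit b t
    go zero    u≡bt = ⊥-elim (<-irrefl u≡bt (≤-<-trans z≤n (t<b*t t 1≤t)))
    go (suc u) u≡bt with suc u % b ≟ 0
    ... | yes _ = trans (cong (λ z → lnzF u b z) (trans (cong (_/ b) u≡bt) (b*t/b≡t t)))
                        (lnzF-fuel u t t (≤-pred (subst (t <_) (sym u≡bt) (t<b*t t 1≤t))) ≤-refl)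
    ... | no u%b≢0 = ⊥-elim (u%b≢0 (trans (cong (_% b) u≡bt) (b*t%b≡0 t)))

  private
    digit%b : ∀ d N → suc d < b → (suc d + b * N) % b ≡ suc d
    digit%b d N d<b = trans (cong (λ x → (suc d + x) % b) (*-comm b N))
                            (trans ([m+kn]%n≡m%n (suc d) N b) (m<n⇒m%n≡m d<b))

    digit%b≢0 : ∀ d N → suc d < b → (suc d + b * N) % b ≢ 0
    digit%b≢0 d N d<b eq = 1+n≢0 (trans (sym (digit%b d N d<b)) eq)

    lastDigit : ∀ d N → suc d < b → lastNonzeroDigit b (suc d + b * N) ≡ suc d
    lastDigit d N d<b = trans (lastNonzeroDigit-nonMultiple _ (digit%b≢0 d N d<b)) (digit%b d N d<b)

  zeroRun-digit≡1 : ∀ k d N → suc d < b → suc d ≡ b ∸ k → zeroRun b k (suc d + b * N) ≡ 1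
  zeroRun-digit≡1 zero    d N d<b d≡b = ⊥-elim (<-irrefl d≡b d<b)
  zeroRun-digit≡1 (suc k) d N d<b d≡b with lastNonzeroDigit b (suc d + b * N) ≟ b ∸ suc k
  ... | yes _ = refl
  ... | no  ℓ≢ = ⊥-elim (ℓ≢ (trans (lastDigit d N d<b) d≡b))

  zeroRun-digit≡0 : ∀ k d N → suc d < b → suc d ≢ b ∸ k → zeroRun b k (suc d + b * N) ≡ 0
  zeroRun-digit≡0 zero    d N d<b _   = trailingZeros-nonMultiple _ (digit%b≢0 d N d<b)
  zeroRun-digit≡0 (suc k) d N d<b d≢b with lastNonzeroDigit b (suc d + b * N) ≟ b ∸ suc k
  ... | yes ℓ≡ = ⊥-elim (d≢b (trans (sym (lastDigit d N d<b)) ℓ≡))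
  ... | no  _  = refl

  zeroRun-b*-zero : ∀ N → zeroRun b 0 (b * suc N) ≡ suc (zeroRun b 0 (suc N))
  zeroRun-b*-zero N = trailingZeros-b* (suc N) (s≤s z≤n)

  zeroRun-b*-suc : ∀ k N → zeroRun b (suc k) (b * suc N) ≡ zeroRun b (suc k) (suc N)
  zeroRun-b*-suc k N with lastNonzeroDigit b (b * suc N) ≟ b ∸ suc k | lastNonzeroDigit b (suc N) ≟ b ∸ suc k
  ... | yes _ | yes _ = refl
  ... | no  _ | no  _ = refl
  ... | yes p | no  q = ⊥-elim (q (trans (sym (lastNonzeroDigit-b* (suc N) (s≤s z≤n))) p))
  ... | no  p | yes q = ⊥-elim (p (trans (lastNonzeroDigit-b* (suc N) (s≤s z≤n)) q))

  private
    module Z (k : ℕ) = BlockSequence (λ t → zeroRun b k t)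

  blockRange-ones : ∀ k N e → e < b ∸ k → Z.blockRange k (b * N) e ≡ replicate e 1
  blockRange-ones k N zero    _   = refl
  blockRange-ones k N (suc e) e<b = trans
    (cong₂ _++_ (blockRange-ones k N e (≤-trans (n≤1+n _) e<b))
                (cong (λ z → 1 ∷ replicate z 0)
                      (zeroRun-digit≡0 k e N (<-≤-trans e<b (m∸n≤m b k)) (λ e≡ → <-irrefl e≡ e<b))))
    (replicate-∷ʳ e 1)

  private
    b≡1+pred : suc (pred b) ≡ b
    b≡1+pred = suc-pred b

    b+b*N : ∀ {d} N → suc d ≡ b → suc (d + b * N) ≡ b * suc N
    b+b*N N sd≡b = trans (cong (_+ b * N) sd≡b) (sym (*-suc b N))

  blockRange-b-zero : ∀ N → Z.blockRange 0 (b * N) b ≡ (replicate b 1 ++ [ 0 ]) ++ replicate (zeroRun b 0 (suc N)) 0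
  blockRange-b-zero N = begin
    Z.blockRange 0 (b * N) b
      ≡⟨ cong (Z.blockRange 0 (b * N)) (sym b≡1+pred) ⟩
    Z.blockRange 0 (b * N) (pred b) ++ 1 ∷ replicate (zeroRun b 0 (suc (pred b + b * N))) 0
      ≡⟨ cong₂ (λ xs z → xs ++ 1 ∷ replicate z 0)
               (blockRange-ones 0 N (pred b) (subst (pred b <_) b≡1+pred ≤-refl))
               (trans (cong (zeroRun b 0) (b+b*N N b≡1+pred)) (zeroRun-b*-zero N)) ⟩
    replicate (pred b) 1 ++ 1 ∷ 0 ∷ Z₊
      ≡⟨ replicate-++-∷ (pred b) 1 _ ⟩
    1 ∷ replicate (pred b) 1 ++ 0 ∷ Z₊
      ≡⟨ cong (1 ∷_) (sym (++-assoc (replicate (pred b) 1) [ 0 ] _)) ⟩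
    (replicate (suc (pred b)) 1 ++ [ 0 ]) ++ Z₊
      ≡⟨ cong (λ n → (replicate n 1 ++ [ 0 ]) ++ Z₊) b≡1+pred ⟩
    (replicate b 1 ++ [ 0 ]) ++ Z₊ ∎
    where
    open ≡-Reasoning
    Z₊ : List ℕ
    Z₊ = replicate (zeroRun b 0 (suc N)) 0

  module _ (k : ℕ) (1+k<b : suc k < b) where

    private
      bk = b ∸ suc k

      bk≡1+pred : suc (pred bk) ≡ bk
      bk≡1+pred = suc-pred bk {{>-nonZero (m<n⇒0<n∸m 1+k<b)}}

    blockRange-marked : ∀ N j → bk + j < b → Z.blockRange (suc k) (b * N) (bk + j) ≡ replicate bk 1 ++ 0 ∷ replicate j 1
    blockRange-marked N zero bk<b = begin
      Z.blockRange (suc k) (b * N) (bk + 0)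
        ≡⟨ cong (Z.blockRange (suc k) (b * N)) (trans (+-identityʳ bk) (sym bk≡1+pred)) ⟩
      Z.blockRange (suc k) (b * N) (pred bk) ++ 1 ∷ replicate (zeroRun b (suc k) (suc (pred bk + b * N))) 0
        ≡⟨ cong₂ (λ xs z → xs ++ 1 ∷ replicate z 0)
                 (blockRange-ones (suc k) N (pred bk) (subst (pred bk <_) bk≡1+pred ≤-refl))
                 (zeroRun-digit≡1 (suc k) (pred bk) N
                    (subst (_< b) (sym bk≡1+pred) (≤-trans (s≤s (m≤m+n bk 0)) bk<b)) bk≡1+pred) ⟩
      replicate (pred bk) 1 ++ 1 ∷ [ 0 ]
        ≡⟨ sym (++-assoc (replicate (pred bk) 1) [ 1 ] [ 0 ]) ⟩
      (replicate (pred bk) 1 ∷ʳ 1) ++ [ 0 ]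
        ≡⟨ cong (_++ [ 0 ]) (trans (replicate-∷ʳ (pred bk) 1) (cong (λ n → replicate n 1) bk≡1+pred)) ⟩
      replicate bk 1 ++ [ 0 ] ∎
      where open ≡-Reasoning
    blockRange-marked N (suc j) bk+j<b = begin
      Z.blockRange (suc k) (b * N) (bk + suc j)
        ≡⟨ cong (Z.blockRange (suc k) (b * N)) (+-suc bk j) ⟩
      Z.blockRange (suc k) (b * N) (bk + j) ++ 1 ∷ replicate (zeroRun b (suc k) (suc (bk + j + b * N))) 0
        ≡⟨ cong₂ (λ xs z → xs ++ 1 ∷ replicate z 0)
                 (blockRange-marked N j (≤-trans (n≤1+n _) bk+1+j<b))
                 (zeroRun-digit≡0 (suc k) (bk + j) N bk+1+j<b (λ q → <-irrefl (sym q) (s≤s (m≤m+n bk j)))) ⟩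
      (replicate bk 1 ++ 0 ∷ replicate j 1) ∷ʳ 1
        ≡⟨ ++-assoc (replicate bk 1) (0 ∷ replicate j 1) [ 1 ] ⟩
      replicate bk 1 ++ 0 ∷ (replicate j 1 ∷ʳ 1)
        ≡⟨ cong (λ xs → replicate bk 1 ++ 0 ∷ xs) (replicate-∷ʳ j 1) ⟩
      replicate bk 1 ++ 0 ∷ replicate (suc j) 1 ∎
      where
      open ≡-Reasoning
      bk+1+j<b : suc (bk + j) < b
      bk+1+j<b = subst (_< b) (+-suc bk j) bk+j<b

    blockRange-b-suc : ∀ N → Z.blockRange (suc k) (b * N) b
                         ≡ (replicate bk 1 ++ 0 ∷ replicate (suc k) 1) ++ replicate (zeroRun b (suc k) (suc N)) 0
    blockRange-b-suc N = begin
      Z.blockRange (suc k) (b * N) b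
        ≡⟨ cong (Z.blockRange (suc k) (b * N)) (sym 1+bk+k≡b) ⟩
      Z.blockRange (suc k) (b * N) (bk + k) ++ 1 ∷ replicate (zeroRun b (suc k) (suc (bk + k + b * N))) 0
        ≡⟨ cong₂ (λ xs z → xs ++ 1 ∷ replicate z 0)
                 (blockRange-marked N k (subst (bk + k <_) 1+bk+k≡b ≤-refl))
                 (trans (cong (zeroRun b (suc k)) (b+b*N N 1+bk+k≡b)) (zeroRun-b*-suc k N)) ⟩
      (replicate bk 1 ++ 0 ∷ replicate k 1) ++ 1 ∷ Z₊
        ≡⟨ ++-assoc (replicate bk 1) _ _ ⟩
      replicate bk 1 ++ 0 ∷ replicate k 1 ++ 1 ∷ Z₊
        ≡⟨ cong (λ xs → replicate bk 1 ++ 0 ∷ xs) (replicate-++-∷ k 1 Z₊) ⟩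
      replicate bk 1 ++ 0 ∷ replicate (suc k) 1 ++ Z₊
        ≡⟨ sym (++-assoc (replicate bk 1) _ _) ⟩
      (replicate bk 1 ++ 0 ∷ replicate (suc k) 1) ++ Z₊ ∎
      where
      open ≡-Reasoning
      Z₊ : List ℕ
      Z₊ = replicate (zeroRun b (suc k) (suc N)) 0
      1+bk+k≡b : suc (bk + k) ≡ b
      1+bk+k≡b = trans (sym (+-suc bk k)) (m∸n+n≡m (<⇒≤ 1+k<b))

  -- Among b N + 1, …, b N + b only b (N + 1) is a multiple of b, and its digits are those of N + 1
  -- followed by a 0; the others end in the digits 1, …, b − 1.
  blockRange-b : ∀ k → k < b → ∀ N → Z.blockRange k (b * N) b
                   ≡ (replicate (b ∸ k) 1 ++ 0 ∷ replicate k 1) ++ replicate (zeroRun b k (suc N)) 0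
  blockRange-b zero    _   = blockRange-b-zero
  blockRange-b (suc k) k<b = blockRange-b-suc k k<b

  module Substitution (k : ℕ) (k<b : k < b) where

    zr : ℕ → ℕ
    zr t = zeroRun b k t

    open BlockSequence zr

    escapeWord : List ℕ
    escapeWord = replicate (b ∸ k) 1 ++ 0 ∷ replicate k 1

    σ : ℕ → List ℕ
    σ e with e ≟ 1
    ... | yes _ = escapeWord
    ... | no  _ = [ 0 ]

    σ-escape : ∀ {e} → e ≡ 1 → σ e ≡ escapeWord
    σ-escape {e} e≡1 with e ≟ 1
    ... | yes _  = refl
    ... | no e≢1 = ⊥-elim (e≢1 e≡1)

    σ-return : ∀ {e} → e ≢ 1 → σ e ≡ [ 0 ]
    σ-return {e} e≢1 with e ≟ 1
    ... | yes e≡1 = ⊥-elim (e≢1 e≡1)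
    ... | no  _   = refl

    concatMap-σ-blocks : ∀ N → concatMap σ (blocks zr N) ≡ blocks zr (b * N)
    concatMap-σ-blocks zero    = cong (blocks zr) (sym (*-zeroʳ b))
    concatMap-σ-blocks (suc N) = begin
      concatMap σ (blocks zr N ++ block (suc N))
        ≡⟨ concatMap-++ σ (blocks zr N) (block (suc N)) ⟩
      concatMap σ (blocks zr N) ++ σ 1 ++ concatMap σ (replicate (zeroRun b k (suc N)) 0)
        ≡⟨ cong₂ _++_ (concatMap-σ-blocks N) (cong₂ _++_ (σ-escape refl) (concatMap-σ-zeros _)) ⟩
      blocks zr (b * N) ++ escapeWord ++ replicate (zeroRun b k (suc N)) 0
        ≡⟨ cong (blocks zr (b * N) ++_) (sym (blockRange-b k k<b N)) ⟩
      blocks zr (b * N) ++ blockRange (b * N) b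
        ≡⟨ sym (blocks-+ (b * N) b) ⟩
      blocks zr (b + b * N)
        ≡⟨ cong (blocks zr) (sym (*-suc b N)) ⟩
      blocks zr (b * suc N) ∎
      where
      open ≡-Reasoning
      concatMap-σ-zeros : ∀ n → concatMap σ (replicate n 0) ≡ replicate n 0
      concatMap-σ-zeros zero    = refl
      concatMap-σ-zeros (suc n) = cong₂ _++_ (σ-return {0} (λ ())) (concatMap-σ-zeros n)

module RotorWalk {b : ℕ} where

  walk : ℕ → State b → State b
  walk m s = fold s step m

  run≡walk : ∀ c m → run c m ≡ walk m (ρ , c)
  run≡walk c zero    = refl
  run≡walk c (suc m) = cong step (run≡walk c m)

  walk-+ : ∀ m n s → walk (m + n) s ≡ walk m (walk n s)
  walk-+ m n s = fold-+ s step m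

  walk-suc : ∀ m s → walk (suc m) s ≡ walk m (step s)
  walk-suc m s = trans (cong (λ n → walk n s) (+-comm 1 m)) (walk-+ m 1 s)

  run-suc : ∀ (c : Config b) m → run c (suc m) ≡ walk m (node [] , c)
  run-suc c m = trans (run≡walk c (suc m)) (walk-suc m (ρ , c))

  walk-from : ∀ {s s'} n → walk n s ≡ s' → ∀ m → n ≤ m → walk m s ≡ walk (m ∸ n) s'
  walk-from {s} n eq m n≤m =
    trans (cong (λ i → walk i s) (sym (m∸n+n≡m n≤m))) (trans (walk-+ (m ∸ n) n s) (cong (walk (m ∸ n)) eq))

  update-same : ∀ (c : Config b) w r → update c w r w ≡ r
  update-same c w r with ≡-dec Fin._≟_ w w
  ... | yes _  = refl
  ... | no w≢w = ⊥-elim (w≢w refl)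

  update-other : ∀ (c : Config b) w r u → u ≢ w → update c w r u ≡ c u
  update-other c w r u u≢w with ≡-dec Fin._≟_ u w
  ... | yes u≡w = ⊥-elim (u≢w u≡w)
  ... | no  _   = refl

  step-node : ∀ (s : State b) w → proj₁ s ≡ node w →
              step s ≡ (neighbour w (next (proj₂ s w)) , update (proj₂ s) w (next (proj₂ s w)))
  step-node (_ , c) w refl = refl

  step-elsewhere : ∀ (s : State b) v → proj₁ s ≢ node v → proj₂ (step s) v ≡ proj₂ s v
  step-elsewhere (ρ      , c) v _   = refl
  step-elsewhere (node w , c) v w≢v = update-other c w _ v (λ { refl → w≢v refl })

  walk-elsewhere : ∀ m (s : State b) v → (∀ m' → m' < m → proj₁ (walk m' s) ≢ node v) →
                   proj₂ (walk m s) v ≡ proj₂ s v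
  walk-elsewhere zero    s v _     = refl
  walk-elsewhere (suc m) s v avoid =
    trans (step-elsewhere (walk m s) v (avoid m ≤-refl))
          (walk-elsewhere m s v (λ m' m'<m → avoid m' (≤-trans m'<m (n≤1+n m))))

  node-injective : ∀ {v v' : List (Fin b)} → node {b} v ≡ node v' → v ≡ v'
  node-injective refl = refl

  InSubtree : List (Fin b) → Vertex b → Set
  InSubtree w ρ        = ⊥
  InSubtree w (node v) = ∃ λ u → v ≡ u ++ w

  InSubtree-parent : ∀ {i w x} → InSubtree (i ∷ w) x → InSubtree w x
  InSubtree-parent {i} {w} {node v} (u , refl) = u ∷ʳ i , sym (++-assoc u [ i ] w)

  InSubtree⇒≢ρ : ∀ {w x} → InSubtree w x → x ≢ ρ
  InSubtree⇒≢ρ {x = node _} _ ()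

  private
    length-below : ∀ (u : List (Fin b)) i w → length w < length (u ++ i ∷ w)
    length-below []      i w = ≤-refl
    length-below (_ ∷ u) i w = ≤-trans (length-below u i w) (n≤1+n _)

  below-≢ : ∀ (u : List (Fin b)) i w → w ≢ u ++ i ∷ w
  below-≢ u i w eq = <-irrefl (cong length eq) (length-below u i w)

  update-below : ∀ (c : Config b) w r u i → update c w r (u ++ i ∷ w) ≡ c (u ++ i ∷ w)
  update-below c w r u i = update-other c w r _ (λ eq → below-≢ u i w (sym eq))

  child-∉-own : ∀ {i w} → ¬ InSubtree (i ∷ w) (node w)
  child-∉-own {i} {w} (u , eq) = below-≢ u i w eq

  sibling-∉ : ∀ {i i' w} u' → i' ≢ i → ¬ InSubtree (i ∷ w) (node (u' ++ i' ∷ w))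
  sibling-∉ {i} {i'} {w} u' i'≢i (u , eq) =
    i'≢i (∷-injectiveˡ (++-cancelˡ-eqlen u' u (+-cancelʳ-≡ _ _ _ lengths) eq))
    where
    lengths : length u' + length (i' ∷ w) ≡ length u + length (i ∷ w)
    lengths = trans (sym (length-++ u')) (trans (cong length eq) (length-++ u))
    ++-cancelˡ-eqlen : ∀ (a c : List (Fin b)) {x y} → length a ≡ length c → a ++ x ≡ c ++ y → x ≡ y
    ++-cancelˡ-eqlen []      []      _  eq = eq
    ++-cancelˡ-eqlen (_ ∷ a) (_ ∷ c) ac eq = ++-cancelˡ-eqlen a c (suc-injective ac) (∷-injectiveʳ eq)

  update-cong : ∀ {c d : Config b} w {r r'} → c ≗ d → r ≡ r' → update c w r ≗ update d w r'
  update-cong w c≗d r≡r' u with ≡-dec Fin._≟_ u w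
  ... | yes _ = r≡r'
  ... | no  _ = c≗d u

  run-cong : ∀ {c d : Config b} → c ≗ d → ∀ m → (pos c m ≡ pos d m) × (cfg c m ≗ cfg d m)
  run-cong c≗d zero    = refl , c≗d
  run-cong {c} {d} c≗d (suc m) = step-cong (run c m) (run d m) (run-cong c≗d m)
    where
    step-cong : ∀ (s s' : State b) → (proj₁ s ≡ proj₁ s') × (proj₂ s ≗ proj₂ s') →
                (proj₁ (step s) ≡ proj₁ (step s')) × (proj₂ (step s) ≗ proj₂ (step s'))
    step-cong (ρ      , _) (_ , _) (refl , h) = refl , h
    step-cong (node w , _) (_ , _) (refl , h) =
      cong (λ r → neighbour w (next r)) (h w) , update-cong w h (cong next (h w))

  Outcome-deterministic : ∀ {c d c' d' : Config b} x y → c ≗ d → Outcome c x c' → Outcome d y d' → x ≡ y × c' ≗ d'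
  Outcome-deterministic zero zero c≗d (M , 1≤M , atM , before , c'≗) (M' , 1≤M' , atM' , before' , d'≗) =
    refl , λ v → trans (sym (c'≗ v))
                       (trans (proj₂ (run-cong c≗d M) v) (trans (cong (λ n → cfg _ n v) M≡M') (d'≗ v)))
    where
    M≡M' : M ≡ M'
    M≡M' with <-cmp M M'
    ... | tri< M<M' _ _ = ⊥-elim (before' M 1≤M M<M' (trans (sym (proj₁ (run-cong c≗d M))) atM))
    ... | tri≈ _ M≡M' _ = M≡M'
    ... | tri> _ _ M'<M = ⊥-elim (before M' 1≤M' M'<M (trans (proj₁ (run-cong c≗d M')) atM'))
  Outcome-deterministic zero (suc zero) c≗d (M , 1≤M , atM , _) (never , _) =
    ⊥-elim (never M 1≤M (trans (sym (proj₁ (run-cong c≗d M))) atM))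
  Outcome-deterministic (suc zero) zero c≗d (never , _) (M , 1≤M , atM , _) =
    ⊥-elim (never M 1≤M (trans (proj₁ (run-cong c≗d M)) atM))
  Outcome-deterministic (suc zero) (suc zero) c≗d (_ , lim) (_ , lim') = refl , λ v →
    let m₀ = proj₁ (lim v) ; m₀' = proj₁ (lim' v) in
    trans (sym (proj₂ (lim v) (m₀ + m₀') (m≤m+n m₀ m₀')))
          (trans (proj₂ (run-cong c≗d (m₀ + m₀')) v) (proj₂ (lim' v) (m₀ + m₀') (m≤n+m m₀' m₀)))
  Outcome-deterministic zero          (suc (suc _)) _ _ ()
  Outcome-deterministic (suc zero)    (suc (suc _)) _ _ ()
  Outcome-deterministic (suc (suc _)) _             _ () _

  escapeSeq-unique : ∀ {c : Config b} {e e'} → IsEscapeSeq c e → IsEscapeSeq c e' → ∀ n → e n ≡ e' n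
  escapeSeq-unique {e = e} {e'} (C , C₀≗c , outcome) (C' , C'₀≗c , outcome') n = proj₁ (agree n)
    where
    agree : ∀ n → e n ≡ e' n × C (suc n) ≗ C' (suc n)
    before : ∀ n → C n ≗ C' n
    before zero    v = trans (C₀≗c v) (sym (C'₀≗c v))
    before (suc n) = proj₂ (agree n)
    agree n = Outcome-deterministic (e n) (e' n) (before n) (outcome n) (outcome' n)

module DivModSuc (n : ℕ) where

  private
    D : ℕ
    D = suc n

  divMod-unique : ∀ o r → o < D → (o + r * D) % D ≡ o × (o + r * D) / D ≡ r
  divMod-unique o r o<D =
    trans ([m+kn]%n≡m%n o r D) (m<n⇒m%n≡m o<D) ,
    trans (+-distrib-/-∣ʳ o (divides-refl r)) (cong₂ _+_ (m<n⇒m/n≡0 o<D) (m*n/n≡m r D))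

  data SucDivMod (P : ℕ) : Set where
    same-block : P % D < n → suc P % D ≡ suc (P % D) → suc P / D ≡ P / D → SucDivMod P
    next-block : P % D ≡ n → suc P % D ≡ 0 → suc P / D ≡ suc (P / D) → SucDivMod P

  divMod-suc : ∀ P → SucDivMod P
  divMod-suc P with P % D <? n
  ... | yes o<n = same-block o<n (trans (cong (_% D) 1+P≡) (proj₁ unique)) (trans (cong (_/ D) 1+P≡) (proj₂ unique))
    where
    1+P≡ : suc P ≡ suc (P % D) + P / D * D
    1+P≡ = cong suc (m≡m%n+[m/n]*n P D)
    unique : (suc (P % D) + P / D * D) % D ≡ suc (P % D) × (suc (P % D) + P / D * D) / D ≡ P / D
    unique = divMod-unique (suc (P % D)) (P / D) (s≤s o<n)
  ... | no  o≮n = next-block o≡n (trans (cong (_% D) 1+P≡) (proj₁ unique)) (trans (cong (_/ D) 1+P≡) (proj₂ unique))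
    where
    o≡n : P % D ≡ n
    o≡n = ≤-antisym (≤-pred (m%n<n P D)) (≮⇒≥ o≮n)
    1+P≡ : suc P ≡ 0 + suc (P / D) * D
    1+P≡ = cong suc (trans (m≡m%n+[m/n]*n P D) (cong (_+ P / D * D) o≡n))
    unique : (0 + suc (P / D) * D) % D ≡ 0 × (0 + suc (P / D) * D) / D ≡ suc (P / D)
    unique = divMod-unique 0 (suc (P / D)) (s≤s z≤n)

module ConstantConfiguration (b k : ℕ) .{{_ : NonZero b}} (2≤b : 2 ≤ b) (k<b : k < b) where

  open ListFacts
  open RotorWalk {b}
  open BaseExpansion b 2≤b using (module Substitution)
  open Substitution k k<b
  open DivModSuc b

  D : ℕ
  D = suc b

  bk : ℕ
  bk = b ∸ k

  bk+k≡b : bk + k ≡ b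
  bk+k≡b = m∸n+n≡m (<⇒≤ k<b)

  1+bk+k≡D : suc bk + k ≡ D
  1+bk+k≡D = cong suc bk+k≡b

  ε : ℕ → ℕ
  ε = escPattern b k

  -- Departure P from a vertex (its (P+1)-st step away from it) has offset P % D in block P / D:
  -- at that time each child has received P / D particles, and offset bk is the step to the parent.
  -- Its output is [ 0 ] if it goes up, [ 1 ] if the child lets the particle escape, and [] if the
  -- child sends it back.
  departureOutput : ℕ → ℕ → List ℕ
  departureOutput o e with o ≟ bk | e ≟ 1
  ... | yes _ | _     = [ 0 ]
  ... | no  _ | yes _ = [ 1 ]
  ... | no  _ | no  _ = []

  departureOutput-parent : ∀ {o} e → o ≡ bk → departureOutput o e ≡ [ 0 ]
  departureOutput-parent {o} e o≡bk with o ≟ bk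
  ... | yes _   = refl
  ... | no o≢bk = ⊥-elim (o≢bk o≡bk)

  departureOutput-escape : ∀ {o e} → o ≢ bk → e ≡ 1 → departureOutput o e ≡ [ 1 ]
  departureOutput-escape {o} {e} o≢bk e≡1 with o ≟ bk | e ≟ 1
  ... | yes o≡bk | _      = ⊥-elim (o≢bk o≡bk)
  ... | no  _    | yes _  = refl
  ... | no  _    | no e≢1 = ⊥-elim (e≢1 e≡1)

  departureOutput-return : ∀ {o e} → o ≢ bk → e ≢ 1 → departureOutput o e ≡ []
  departureOutput-return {o} {e} o≢bk e≢1 with o ≟ bk | e ≟ 1
  ... | yes o≡bk | _       = ⊥-elim (o≢bk o≡bk)
  ... | no  _    | yes e≡1 = ⊥-elim (e≢1 e≡1)
  ... | no  _    | no  _   = refl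

  output : ℕ → List ℕ
  output P = departureOutput (P % D) (ε (P / D))

  outputs : ℕ → List ℕ
  outputs zero    = []
  outputs (suc P) = outputs P ++ output P

  blockOutputs : ℕ → ℕ → List ℕ
  blockOutputs e zero    = []
  blockOutputs e (suc o) = blockOutputs e o ++ departureOutput o e

  outputs-⊑ : ∀ {P Q} → P ≤ Q → outputs P ⊑ outputs Q
  outputs-⊑ = ⊑-monotone outputs (λ P → ⊑-++ (outputs P) _)

  outputs-within-block : ∀ r o → o ≤ D → outputs (o + r * D) ≡ outputs (r * D) ++ blockOutputs (ε r) o
  outputs-within-block r zero    _     = sym (++-identityʳ _)
  outputs-within-block r (suc o) 1+o≤D =
    trans (cong₂ _++_ (outputs-within-block r o (≤-trans (n≤1+n o) 1+o≤D))
                      (cong₂ departureOutput o%D≡o (cong ε o/D≡r)))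
          (++-assoc (outputs (r * D)) (blockOutputs (ε r) o) _)
    where
    o%D≡o : (o + r * D) % D ≡ o
    o%D≡o = proj₁ (divMod-unique o r 1+o≤D)
    o/D≡r : (o + r * D) / D ≡ r
    o/D≡r = proj₂ (divMod-unique o r 1+o≤D)

  blockOutputs-escape-ones : ∀ {e} → e ≡ 1 → ∀ o → o ≤ bk → blockOutputs e o ≡ replicate o 1
  blockOutputs-escape-ones e≡1 zero    _      = refl
  blockOutputs-escape-ones e≡1 (suc o) 1+o≤bk =
    trans (cong₂ _++_ (blockOutputs-escape-ones e≡1 o (≤-trans (n≤1+n o) 1+o≤bk))
                      (departureOutput-escape (λ o≡bk → <-irrefl o≡bk 1+o≤bk) e≡1))
          (replicate-∷ʳ o 1)

  blockOutputs-escape : ∀ {e} → e ≡ 1 → ∀ j → j ≤ k →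
                        blockOutputs e (suc bk + j) ≡ replicate bk 1 ++ 0 ∷ replicate j 1
  blockOutputs-escape {e} e≡1 zero _ =
    trans (cong (blockOutputs e) (+-identityʳ (suc bk)))
          (cong₂ _++_ (blockOutputs-escape-ones e≡1 bk ≤-refl) (departureOutput-parent e refl))
  blockOutputs-escape {e} e≡1 (suc j) 1+j≤k = begin
    blockOutputs e (suc bk + suc j)
      ≡⟨ cong (blockOutputs e) (+-suc (suc bk) j) ⟩
    blockOutputs e (suc bk + j) ++ departureOutput (suc bk + j) e
      ≡⟨ cong₂ _++_ (blockOutputs-escape e≡1 j (≤-trans (n≤1+n j) 1+j≤k))
                    (departureOutput-escape (λ q → <-irrefl (sym q) (s≤s (m≤m+n bk j))) e≡1) ⟩
    (replicate bk 1 ++ 0 ∷ replicate j 1) ∷ʳ 1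
      ≡⟨ ++-assoc (replicate bk 1) (0 ∷ replicate j 1) [ 1 ] ⟩
    replicate bk 1 ++ 0 ∷ (replicate j 1 ∷ʳ 1)
      ≡⟨ cong (λ xs → replicate bk 1 ++ 0 ∷ xs) (replicate-∷ʳ j 1) ⟩
    replicate bk 1 ++ 0 ∷ replicate (suc j) 1 ∎
    where open ≡-Reasoning

  blockOutputs-return-empty : ∀ {e} → e ≢ 1 → ∀ o → o ≤ bk → blockOutputs e o ≡ []
  blockOutputs-return-empty e≢1 zero    _      = refl
  blockOutputs-return-empty e≢1 (suc o) 1+o≤bk =
    cong₂ _++_ (blockOutputs-return-empty e≢1 o (≤-trans (n≤1+n o) 1+o≤bk))
               (departureOutput-return (λ o≡bk → <-irrefl o≡bk 1+o≤bk) e≢1)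

  blockOutputs-return : ∀ {e} → e ≢ 1 → ∀ j → blockOutputs e (suc bk + j) ≡ [ 0 ]
  blockOutputs-return {e} e≢1 zero =
    trans (cong (blockOutputs e) (+-identityʳ (suc bk)))
          (cong₂ _++_ (blockOutputs-return-empty e≢1 bk ≤-refl) (departureOutput-parent e refl))
  blockOutputs-return {e} e≢1 (suc j) =
    trans (cong (blockOutputs e) (+-suc (suc bk) j))
          (cong₂ _++_ (blockOutputs-return e≢1 j)
                      (departureOutput-return (λ q → <-irrefl (sym q) (s≤s (m≤m+n bk j))) e≢1))

  blockOutputs-D : ∀ e → blockOutputs e D ≡ σ e
  blockOutputs-D e = trans (cong (blockOutputs e) (sym 1+bk+k≡D)) (by-cases (e ≟ 1))
    where
    by-cases : Dec (e ≡ 1) → blockOutputs e (suc bk + k) ≡ σ e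
    by-cases (yes e≡1) = trans (blockOutputs-escape e≡1 k ≤-refl) (sym (σ-escape e≡1))
    by-cases (no  e≢1) = trans (blockOutputs-return e≢1 k) (sym (σ-return e≢1))

  outputs-*D : ∀ r → outputs (r * D) ≡ concatMap σ (applyUpTo ε r)
  outputs-*D zero    = refl
  outputs-*D (suc r) = begin
    outputs (D + r * D)
      ≡⟨ outputs-within-block r D ≤-refl ⟩
    outputs (r * D) ++ blockOutputs (ε r) D
      ≡⟨ cong₂ _++_ (outputs-*D r) (blockOutputs-D (ε r)) ⟩
    concatMap σ (applyUpTo ε r) ++ σ (ε r)
      ≡⟨ cong (concatMap σ (applyUpTo ε r) ++_) (sym (++-identityʳ (σ (ε r)))) ⟩
    concatMap σ (applyUpTo ε r) ++ concatMap σ [ ε r ]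
      ≡⟨ sym (concatMap-++ σ (applyUpTo ε r) [ ε r ]) ⟩
    concatMap σ (applyUpTo ε r ∷ʳ ε r)
      ≡⟨ cong (concatMap σ) (applyUpTo-∷ʳ ε r) ⟩
    concatMap σ (applyUpTo ε (suc r)) ∎
    where open ≡-Reasoning

  open BlockSequence zr

  outputs-PrefixOf : ∀ P → PrefixOf (outputs P) ε
  outputs-PrefixOf P = PrefixOf-⊑ outputs⊑blocks (blocks-PrefixOf (b * P))
    where
    applyUpTo⊑blocks : applyUpTo ε P ⊑ blocks zr P
    applyUpTo⊑blocks = subst (applyUpTo ε P ⊑_)
      (sym (PrefixOf⇒applyUpTo (blocks zr P) (blocks-PrefixOf P)))
      (applyUpTo-⊑ ε (length-blocks P))
    outputs⊑blocks : outputs P ⊑ blocks zr (b * P)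
    outputs⊑blocks = ⊑-trans (outputs-⊑ (m≤m*n P D))
      (subst (_⊑ blocks zr (b * P)) (sym (outputs-*D P))
        (subst (concatMap σ (applyUpTo ε P) ⊑_) (concatMap-σ-blocks P) (concatMap-⊑ σ applyUpTo⊑blocks)))

  -- A departure is terminal when it ends the visit of the particle making it.
  Terminal : ℕ → Set
  Terminal P = P % D ≡ bk ⊎ ε (P / D) ≡ 1

  terminal? : ∀ P → Dec (Terminal P)
  terminal? P with P % D ≟ bk | ε (P / D) ≟ 1
  ... | yes o≡bk | _       = yes (inj₁ o≡bk)
  ... | no  _    | yes e≡1 = yes (inj₂ e≡1)
  ... | no  o≢bk | no  e≢1 = no λ { (inj₁ o≡bk) → o≢bk o≡bk ; (inj₂ e≡1) → e≢1 e≡1 }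

  -- The first terminal departure at or after offset o of block r: if the children let the r-th
  -- particle escape, every departure of block r is terminal, otherwise only offset bk is.
  nextTerminalIn : ℕ → ℕ → ℕ
  nextTerminalIn r o with ε r ≟ 1 | o ≤? bk | ε (suc r) ≟ 1
  ... | yes _ | _     | _     = o + r * D
  ... | no  _ | yes _ | _     = bk + r * D
  ... | no  _ | no  _ | yes _ = suc r * D
  ... | no  _ | no  _ | no  _ = bk + suc r * D

  nextTerminal : ℕ → ℕ
  nextTerminal P = nextTerminalIn (P / D) (P % D)

  nextTerminalIn-escape : ∀ r o → ε r ≡ 1 → nextTerminalIn r o ≡ o + r * D
  nextTerminalIn-escape r o e≡1 with ε r ≟ 1
  ... | yes _  = refl
  ... | no e≢1 = ⊥-elim (e≢1 e≡1)

  nextTerminalIn-parent : ∀ r o → ε r ≢ 1 → o ≤ bk → nextTerminalIn r o ≡ bk + r * D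
  nextTerminalIn-parent r o e≢1 o≤bk with ε r ≟ 1 | o ≤? bk
  ... | yes e≡1 | _       = ⊥-elim (e≢1 e≡1)
  ... | no  _   | yes _   = refl
  ... | no  _   | no o≰bk = ⊥-elim (o≰bk o≤bk)

  nextTerminalIn-next : ∀ r o → ε r ≢ 1 → ¬ o ≤ bk → nextTerminalIn r o ≡ nextTerminalIn (suc r) 0
  nextTerminalIn-next r o e≢1 o≰bk with ε r ≟ 1 | o ≤? bk | ε (suc r) ≟ 1
  ... | yes e≡1 | _       | _     = ⊥-elim (e≢1 e≡1)
  ... | no  _   | yes o≤bk | _    = ⊥-elim (o≰bk o≤bk)
  ... | no  _   | no  _   | yes _ = refl
  ... | no  _   | no  _   | no  _ with 0 ≤? bk
  ...   | yes _  = refl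
  ...   | no 0≰bk = ⊥-elim (0≰bk z≤n)

  nextTerminalIn-≥ : ∀ r → suc r * D ≤ nextTerminalIn (suc r) 0
  nextTerminalIn-≥ r with ε (suc r) ≟ 1
  ... | yes _ = ≤-refl
  ... | no  _ with 0 ≤? bk
  ...   | yes _   = m≤n+m _ bk
  ...   | no 0≰bk = ⊥-elim (0≰bk z≤n)

  nextTerminal-terminal : ∀ P → Terminal P → nextTerminal P ≡ P
  nextTerminal-terminal P (inj₂ e≡1) = trans (nextTerminalIn-escape (P / D) (P % D) e≡1) (sym (m≡m%n+[m/n]*n P D))
  nextTerminal-terminal P (inj₁ o≡bk) = by-cases (ε (P / D) ≟ 1)
    where
    by-cases : Dec (ε (P / D) ≡ 1) → nextTerminal P ≡ P
    by-cases (yes e≡1) = nextTerminal-terminal P (inj₂ e≡1)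
    by-cases (no  e≢1) = trans (nextTerminalIn-parent (P / D) (P % D) e≢1 (≤-reflexive o≡bk))
                               (trans (cong (_+ P / D * D) (sym o≡bk)) (sym (m≡m%n+[m/n]*n P D)))

  nextTerminal-suc : ∀ P → ¬ Terminal P → nextTerminal (suc P) ≡ nextTerminal P
  nextTerminal-suc P nonterminal with divMod-suc P
  ... | same-block _ o'≡1+o r'≡r = trans (cong₂ nextTerminalIn r'≡r o'≡1+o) (by-cases (P % D ≤? bk))
    where
    by-cases : Dec (P % D ≤ bk) → nextTerminalIn (P / D) (suc (P % D)) ≡ nextTerminal P
    by-cases (yes o≤bk) =
      trans (nextTerminalIn-parent (P / D) (suc (P % D)) (nonterminal ∘ inj₂) (≤∧≢⇒< o≤bk (nonterminal ∘ inj₁)))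
            (sym (nextTerminalIn-parent (P / D) (P % D) (nonterminal ∘ inj₂) o≤bk))
    by-cases (no o≰bk) =
      trans (nextTerminalIn-next (P / D) (suc (P % D)) (nonterminal ∘ inj₂) (o≰bk ∘ ≤-trans (n≤1+n _)))
            (sym (nextTerminalIn-next (P / D) (P % D) (nonterminal ∘ inj₂) o≰bk))
  ... | next-block o≡b o'≡0 r'≡1+r =
    trans (cong₂ nextTerminalIn r'≡1+r o'≡0) (sym (nextTerminalIn-next (P / D) (P % D) (nonterminal ∘ inj₂) o≰bk))
    where
    o≰bk : ¬ P % D ≤ bk
    o≰bk o≤bk = nonterminal (inj₁ (≤-antisym o≤bk (subst (bk ≤_) (sym o≡b) (m∸n≤m b k))))

  nextTerminal-> : ∀ P → ¬ Terminal P → P < nextTerminal P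
  nextTerminal-> P nonterminal = subst (_< nextTerminal P) (sym (m≡m%n+[m/n]*n P D)) (by-cases (P % D ≤? bk))
    where
    by-cases : Dec (P % D ≤ bk) → P % D + P / D * D < nextTerminal P
    by-cases (yes o≤bk) =
      subst (P % D + P / D * D <_) (sym (nextTerminalIn-parent (P / D) (P % D) (nonterminal ∘ inj₂) o≤bk))
            (+-monoˡ-< (P / D * D) (≤∧≢⇒< o≤bk (nonterminal ∘ inj₁)))
    by-cases (no o≰bk) =
      subst (P % D + P / D * D <_) (sym (nextTerminalIn-next (P / D) (P % D) (nonterminal ∘ inj₂) o≰bk))
            (<-≤-trans (+-monoˡ-< (P / D * D) (m%n<n P D)) (nextTerminalIn-≥ (P / D)))

  P≤nextTerminal : ∀ P → P ≤ nextTerminal P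
  P≤nextTerminal P with terminal? P
  ... | yes term    = ≤-reflexive (sym (nextTerminal-terminal P term))
  ... | no  nonterm = <⇒≤ (nextTerminal-> P nonterm)

  nextTerminal-spec : ∀ P → Terminal (nextTerminal P) × outputs (nextTerminal P) ≡ outputs P
  nextTerminal-spec P = go (nextTerminal P ∸ P) P (sym (m∸n+n≡m (P≤nextTerminal P)))
    where
    go : ∀ n P → nextTerminal P ≡ n + P → Terminal (nextTerminal P) × outputs (nextTerminal P) ≡ outputs P
    go n P _ with terminal? P
    ... | yes term = subst Terminal (sym (nextTerminal-terminal P term)) term , cong outputs (nextTerminal-terminal P term)
    go zero    P nt≡P   | no nonterm = ⊥-elim (<-irrefl (sym nt≡P) (nextTerminal-> P nonterm))
    go (suc n) P nt≡n+P | no nonterm =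
      subst Terminal nt≡ (proj₁ ih) ,
      trans (cong outputs (sym nt≡))
            (trans (proj₂ ih) (trans (cong (outputs P ++_) (departureOutput-return (nonterm ∘ inj₁) (nonterm ∘ inj₂)))
                                     (++-identityʳ _)))
      where
      nt≡ : nextTerminal (suc P) ≡ nextTerminal P
      nt≡ = nextTerminal-suc P nonterm
      ih : Terminal (nextTerminal (suc P)) × outputs (nextTerminal (suc P)) ≡ outputs (suc P)
      ih = go n (suc P) (trans nt≡ (trans nt≡n+P (sym (+-suc n P))))

  Terminal⇒escape : ∀ {P} → Terminal P → P % D ≢ bk → ε (P / D) ≡ 1
  Terminal⇒escape (inj₁ o≡bk) o≢bk = ⊥-elim (o≢bk o≡bk)
  Terminal⇒escape (inj₂ e≡1)  _    = e≡1

  output-terminal-singleton : ∀ P → Terminal P → ∃ λ v → output P ≡ [ v ]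
  output-terminal-singleton P term = by-cases (P % D ≟ bk)
    where
    by-cases : Dec (P % D ≡ bk) → ∃ λ v → output P ≡ [ v ]
    by-cases (yes o≡bk) = 0 , departureOutput-parent (ε (P / D)) o≡bk
    by-cases (no  o≢bk) = 1 , departureOutput-escape o≢bk (Terminal⇒escape {P} term o≢bk)

  output≡ε : ∀ P j {v} → outputs P ≡ applyUpTo ε j → output P ≡ [ v ] → v ≡ ε j
  output≡ε P j {v} before last = ∷ʳ-injectiveʳ (applyUpTo ε j) (applyUpTo ε j) (begin
    applyUpTo ε j ∷ʳ v                      ≡⟨ sym outputs≡ ⟩
    outputs (suc P)                         ≡⟨ PrefixOf⇒applyUpTo (outputs (suc P)) (outputs-PrefixOf (suc P)) ⟩
    applyUpTo ε (length (outputs (suc P)))  ≡⟨ cong (applyUpTo ε) length≡ ⟩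
    applyUpTo ε (suc j)                     ≡⟨ sym (applyUpTo-∷ʳ ε j) ⟩
    applyUpTo ε j ∷ʳ ε j                    ∎)
    where
    open ≡-Reasoning
    outputs≡ : outputs (suc P) ≡ applyUpTo ε j ∷ʳ v
    outputs≡ = cong₂ _++_ before last
    length≡ : length (outputs (suc P)) ≡ suc j
    length≡ = trans (cong length outputs≡)
                (trans (length-++ (applyUpTo ε j)) (trans (cong (_+ 1) (length-applyUpTo ε j)) (+-comm j 1)))

  -- T j is the number of departures from a vertex after j particles have entered it and left or escaped.
  T : ℕ → ℕ
  T zero    = 0
  T (suc j) = suc (nextTerminal (T j))

  outputs-T : ∀ j → outputs (T j) ≡ applyUpTo ε j
  outputs-T zero    = refl
  outputs-T (suc j) with nextTerminal-spec (T j)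
  ... | terminal , outputs≡ with output-terminal-singleton (nextTerminal (T j)) terminal
  ... | v , last = begin
    outputs (nextTerminal (T j)) ++ output (nextTerminal (T j))
      ≡⟨ cong₂ _++_ before last ⟩
    applyUpTo ε j ∷ʳ v
      ≡⟨ cong (applyUpTo ε j ∷ʳ_) (output≡ε (nextTerminal (T j)) j before last) ⟩
    applyUpTo ε j ∷ʳ ε j
      ≡⟨ applyUpTo-∷ʳ ε j ⟩
    applyUpTo ε (suc j) ∎
    where
    open ≡-Reasoning
    before : outputs (nextTerminal (T j)) ≡ applyUpTo ε j
    before = trans outputs≡ (outputs-T j)

  private
    length-concatMap-σ : ∀ xs → length xs ≤ length (concatMap σ xs)
    length-concatMap-σ []       = z≤n
    length-concatMap-σ (x ∷ xs) = subst (suc (length xs) ≤_) (sym (length-++ (σ x)))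
      (+-mono-≤ (σ-nonempty x) (length-concatMap-σ xs))
      where
      σ-nonempty : ∀ e → 1 ≤ length (σ e)
      σ-nonempty e with e ≟ 1
      ... | yes _ = subst (1 ≤_) (sym (length-++ (replicate bk 1))) (≤-trans (s≤s z≤n) (m≤n+m _ _))
      ... | no  _ = s≤s z≤n

    2≤length-escapeWord : 2 ≤ length escapeWord
    2≤length-escapeWord = subst (2 ≤_) (sym (length-++ (replicate bk 1)))
      (subst (λ n → 2 ≤ n + suc (length (replicate k 1))) (sym (length-replicate bk))
        (+-mono-≤ (m<n⇒0<n∸m k<b) (s≤s z≤n)))

  -- Since ε 0 = 1, the first block of departures already produces a whole escapeWord.
  block<outputs : ∀ P → 1 ≤ P / D → P / D < length (outputs P)
  block<outputs P 1≤r with P / D | m/n*n≤m P D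
  ... | suc r | rD≤P =
    ≤-trans (subst (λ xs → suc (suc r) ≤ length xs) (sym (outputs-*D (suc r))) first-block) (⊑-length (outputs-⊑ rD≤P))
    where
    later : List ℕ
    later = concatMap σ (applyUpTo (ε ∘ suc) r)
    r≤later : r ≤ length later
    r≤later = subst (_≤ length later) (length-applyUpTo (ε ∘ suc) r) (length-concatMap-σ (applyUpTo (ε ∘ suc) r))
    first-block : suc (suc r) ≤ length (escapeWord ++ later)
    first-block = subst (suc (suc r) ≤_) (sym (length-++ escapeWord)) (+-mono-≤ 2≤length-escapeWord r≤later)

  block<particles : ∀ P j → outputs P ≡ applyUpTo ε j → 1 ≤ P / D → P / D < j
  block<particles P j outputs≡ 1≤r =
    subst (P / D <_) (trans (cong length outputs≡) (length-applyUpTo ε j)) (block<outputs P 1≤r)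

  rotor : ℕ → ℕ
  rotor P = (k + P) % D

  toℕ-next-rotor : ∀ P (f : Fin D) → toℕ f ≡ rotor P → toℕ (next f) ≡ rotor (suc P)
  toℕ-next-rotor P f f≡ = begin
    toℕ (next f)                  ≡⟨ toℕ-fromℕ< _ ⟩
    suc (toℕ f) % D               ≡⟨ cong (λ n → suc n % D) f≡ ⟩
    (1 + (k + P) % D) % D         ≡⟨ %-distribˡ-+ 1 ((k + P) % D) D ⟩
    (1 % D + (k + P) % D % D) % D ≡⟨ cong (λ n → (1 % D + n) % D) (m%n%n≡m%n (k + P) D) ⟩
    (1 % D + (k + P) % D) % D     ≡⟨ sym (%-distribˡ-+ 1 (k + P) D) ⟩
    suc (k + P) % D               ≡⟨ cong (_% D) (sym (+-suc k P)) ⟩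
    (k + suc P) % D               ∎
    where open ≡-Reasoning

  offset : Fin b → ℕ
  offset i with k ≤? toℕ i
  ... | yes _ = toℕ i ∸ k
  ... | no  _ = toℕ i + suc bk

  offset-≥ : ∀ {i} → k ≤ toℕ i → offset i ≡ toℕ i ∸ k
  offset-≥ {i} k≤i with k ≤? toℕ i
  ... | yes _   = refl
  ... | no  k≰i = ⊥-elim (k≰i k≤i)

  offset-< : ∀ {i} → ¬ k ≤ toℕ i → offset i ≡ toℕ i + suc bk
  offset-< {i} k≰i with k ≤? toℕ i
  ... | yes k≤i = ⊥-elim (k≰i k≤i)
  ... | no  _   = refl

  offset≤b : ∀ i → offset i ≤ b
  offset≤b i with k ≤? toℕ i
  ... | yes _   = ≤-trans (m∸n≤m (toℕ i) k) (<⇒≤ (toℕ<n i))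
  ... | no  k≰i = subst (_≤ b) (sym (+-suc (toℕ i) bk))
                    (subst (suc (toℕ i) + bk ≤_) (trans (+-comm k bk) bk+k≡b) (+-monoˡ-≤ bk (≰⇒> k≰i)))

  offset≢bk : ∀ i → offset i ≢ bk
  offset≢bk i with k ≤? toℕ i
  ... | yes k≤i = λ o≡bk → <-irrefl o≡bk (∸-monoˡ-< (toℕ<n i) k≤i)
  ... | no  _   = λ o≡bk → <-irrefl (sym o≡bk) (subst (bk <_) (sym (+-suc (toℕ i) bk)) (s≤s (m≤n+m bk (toℕ i))))

  offset-injective : ∀ i i' → offset i ≡ offset i' → i ≡ i'
  offset-injective i i' o≡o' with k ≤? toℕ i | k ≤? toℕ i'
  ... | yes k≤i | yes k≤i' = toℕ-injective (trans (sym (m∸n+n≡m k≤i)) (trans (cong (_+ k) o≡o') (m∸n+n≡m k≤i')))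
  ... | no  _   | no  _    = toℕ-injective (+-cancelʳ-≡ _ _ _ o≡o')
  ... | yes k≤i | no  _    = ⊥-elim (<-irrefl o≡o' (<-≤-trans (∸-monoˡ-< (toℕ<n i) k≤i) (≤-trans (n≤1+n bk) (m≤n+m _ _))))
  ... | no  _   | yes k≤i' = ⊥-elim (<-irrefl (sym o≡o') (<-≤-trans (∸-monoˡ-< (toℕ<n i') k≤i') (≤-trans (n≤1+n bk) (m≤n+m _ _))))

  data Departure (P : ℕ) : Set where
    toParent : P % D ≡ bk → rotor (suc P) ≡ 0 → Departure P
    toChild  : ∀ i → P % D ≢ bk → rotor (suc P) ≡ suc (toℕ i) → offset i ≡ P % D → Departure P

  rotor-suc : ∀ P → rotor (suc P) ≡ (k + suc (P % D)) % D
  rotor-suc P = begin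
    (k + suc P) % D                      ≡⟨ cong (λ n → (k + suc n) % D) (m≡m%n+[m/n]*n P D) ⟩
    (k + suc (P % D + P / D * D)) % D    ≡⟨ cong (_% D) (sym (+-assoc k (suc (P % D)) (P / D * D))) ⟩
    (k + suc (P % D) + P / D * D) % D    ≡⟨ [m+kn]%n≡m%n (k + suc (P % D)) (P / D) D ⟩
    (k + suc (P % D)) % D                ∎
    where open ≡-Reasoning

  departure-below : ∀ P → P % D < bk → Departure P
  departure-below P o<bk = toChild i (λ o≡bk → <-irrefl o≡bk o<bk) rotor≡ offset≡
    where
    k+o<b : k + P % D < b
    k+o<b = subst (k + P % D <_) (trans (+-comm k bk) bk+k≡b) (+-monoʳ-< k o<bk)
    i : Fin b
    i = fromℕ< k+o<b
    rotor≡ : rotor (suc P) ≡ suc (toℕ i)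
    rotor≡ = trans (rotor-suc P) (trans (cong (_% D) (+-suc k (P % D)))
               (trans (m<n⇒m%n≡m (s≤s k+o<b)) (cong suc (sym (toℕ-fromℕ< k+o<b)))))
    offset≡ : offset i ≡ P % D
    offset≡ = trans (offset-≥ (subst (k ≤_) (sym (toℕ-fromℕ< k+o<b)) (m≤m+n k (P % D))))
                    (trans (cong (_∸ k) (toℕ-fromℕ< k+o<b)) (m+n∸m≡n k (P % D)))

  departure-at : ∀ P → P % D ≡ bk → Departure P
  departure-at P o≡bk = toParent o≡bk (trans (rotor-suc P) (trans (cong (λ n → (k + suc n) % D) o≡bk)
    (trans (cong (_% D) (trans (+-suc k bk) (cong suc (trans (+-comm k bk) bk+k≡b)))) (n%n≡0 D))))

  departure-above : ∀ P → bk < P % D → Departure P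
  departure-above P bk<o = toChild i (λ o≡bk → <-irrefl (sym o≡bk) bk<o) rotor≡ offset≡
    where
    t : ℕ
    t = P % D ∸ suc bk
    o≡1+bk+t : P % D ≡ suc bk + t
    o≡1+bk+t = sym (m+[n∸m]≡n bk<o)
    t<k : t < k
    t<k = +-cancelˡ-< bk t k (subst (_≤ bk + k) o≡1+bk+t (subst (P % D ≤_) (sym bk+k≡b) (≤-pred (m%n<n P D))))
    t<b : t < b
    t<b = <-trans t<k k<b
    i : Fin b
    i = fromℕ< t<b
    k+2+bk+t≡1+t+D : k + suc (suc bk + t) ≡ suc t + D
    k+2+bk+t≡1+t+D = trans (rearrange k bk t) (cong (λ n → suc t + suc n) bk+k≡b)
      where
      rearrange : ∀ k bk t → k + suc (suc bk + t) ≡ suc t + suc (bk + k)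
      rearrange = solve-∀
    rotor≡ : rotor (suc P) ≡ suc (toℕ i)
    rotor≡ = begin
      rotor (suc P)                 ≡⟨ rotor-suc P ⟩
      (k + suc (P % D)) % D         ≡⟨ cong (λ n → (k + suc n) % D) o≡1+bk+t ⟩
      (k + suc (suc bk + t)) % D    ≡⟨ cong (_% D) k+2+bk+t≡1+t+D ⟩
      (suc t + D) % D               ≡⟨ [m+n]%n≡m%n (suc t) D ⟩
      suc t % D                     ≡⟨ m<n⇒m%n≡m (s≤s t<b) ⟩
      suc t                         ≡⟨ cong suc (sym (toℕ-fromℕ< t<b)) ⟩
      suc (toℕ i)                   ∎
      where open ≡-Reasoning
    offset≡ : offset i ≡ P % D
    offset≡ = trans (offset-< (λ k≤i → <-irrefl refl (<-≤-trans t<k (subst (k ≤_) (toℕ-fromℕ< t<b) k≤i))))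
                    (trans (cong (_+ suc bk) (toℕ-fromℕ< t<b)) (trans (+-comm t (suc bk)) (sym o≡1+bk+t)))

  departure : ∀ P → Departure P
  departure P with <-cmp (P % D) bk
  ... | tri< o<bk _ _ = departure-below P o<bk
  ... | tri≈ _ o≡bk _ = departure-at P o≡bk
  ... | tri> _ _ bk<o = departure-above P bk<o

  entries : ℕ → Fin b → ℕ
  entries P i with offset i <? P % D
  ... | yes _ = suc (P / D)
  ... | no  _ = P / D

  entries-> : ∀ P i → offset i < P % D → entries P i ≡ suc (P / D)
  entries-> P i o<o' with offset i <? P % D
  ... | yes _    = refl
  ... | no  o≮o' = ⊥-elim (o≮o' o<o')

  entries-≤ : ∀ P i → ¬ offset i < P % D → entries P i ≡ P / D
  entries-≤ P i o≮o' with offset i <? P % D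
  ... | yes o<o' = ⊥-elim (o≮o' o<o')
  ... | no  _    = refl

  entries-zero : ∀ i → entries 0 i ≡ 0
  entries-zero i = entries-≤ 0 i (λ ())

  entries-suc-self : ∀ P i → offset i ≡ P % D → entries P i ≡ P / D × entries (suc P) i ≡ suc (P / D)
  entries-suc-self P i o≡ = entries-≤ P i (λ o<o → <-irrefl o≡ o<o) , by-cases (divMod-suc P)
    where
    by-cases : SucDivMod P → entries (suc P) i ≡ suc (P / D)
    by-cases (same-block _ o'≡1+o r'≡r) =
      trans (entries-> (suc P) i (subst (offset i <_) (sym o'≡1+o) (s≤s (≤-reflexive o≡)))) (cong suc r'≡r)
    by-cases (next-block _ o'≡0 r'≡1+r) = trans (entries-≤ (suc P) i (n≮0 ∘ subst (offset i <_) o'≡0)) r'≡1+r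

  entries-suc-other : ∀ P i → offset i ≢ P % D → entries (suc P) i ≡ entries P i
  entries-suc-other P i o≢ = by-cases (divMod-suc P) (offset i <? P % D)
    where
    by-cases : SucDivMod P → Dec (offset i < P % D) → entries (suc P) i ≡ entries P i
    by-cases (same-block _ o'≡1+o r'≡r) (yes o<o') =
      trans (entries-> (suc P) i (subst (offset i <_) (sym o'≡1+o) (m<n⇒m<1+n o<o')))
            (trans (cong suc r'≡r) (sym (entries-> P i o<o')))
    by-cases (same-block _ o'≡1+o r'≡r) (no o≮o') =
      trans (entries-≤ (suc P) i (λ o<1+o' → o≮o' (≤∧≢⇒< (≤-pred (subst (offset i <_) o'≡1+o o<1+o')) o≢)))
            (trans r'≡r (sym (entries-≤ P i o≮o')))
    by-cases (next-block o≡b o'≡0 r'≡1+r) _ =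
      trans (entries-≤ (suc P) i (n≮0 ∘ subst (offset i <_) o'≡0))
            (trans r'≡1+r (sym (entries-> P i (≤∧≢⇒< (subst (offset i ≤_) (sym o≡b) (offset≤b i)) o≢))))

  -- The rotor, after P departures from the top of a subtree, at the vertex reached from the top
  -- along the downward path v.
  rotorConfig : ℕ → List (Fin b) → ℕ
  rotorConfig P []      = rotor P
  rotorConfig P (i ∷ v) = rotorConfig (T (entries P i)) v

  rotorConfig<D : ∀ P v → rotorConfig P v < D
  rotorConfig<D P []      = m%n<n (k + P) D
  rotorConfig<D P (i ∷ v) = rotorConfig<D (T (entries P i)) v

  -- Vertex lists are read upwards, hence the reversal of the path u from w.
  Agree : Config b → List (Fin b) → ℕ → Set
  Agree c w P = ∀ u → toℕ (c (u ++ w)) ≡ rotorConfig P (reverse u)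

  Agree-child : ∀ {c w P} → Agree c w P → ∀ i → Agree c (i ∷ w) (T (entries P i))
  Agree-child {c} {w} {P} agree i u =
    trans (cong (toℕ ∘ c) (sym (++-assoc u [ i ] w))) (trans (agree (u ∷ʳ i)) (cong (rotorConfig P) (reverse-++ u [ i ])))

  Agree-intro : ∀ {c w P} → toℕ (c w) ≡ rotor P → (∀ i → Agree c (i ∷ w) (T (entries P i))) → Agree c w P
  Agree-intro {c} {w} {P} top below u with reverseView u
  ... | []          = top
  ... | u' ∶ _ ∶ʳ i = trans (cong (toℕ ∘ c) (++-assoc u' [ i ] w))
                            (trans (below i u') (cong (rotorConfig P) (sym (reverse-++ u' [ i ]))))

  ReturnsAt : List (Fin b) → State b → ℕ → ℕ → Set
  ReturnsAt w s P m = proj₁ (walk m s) ≡ parentOf w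
                    × (∀ m' → m' < m → InSubtree w (proj₁ (walk m' s)))
                    × Agree (proj₂ (walk m s)) w P

  Stabilises : State b → List (Fin b) → ℕ → Set
  Stabilises s v r = ∃ λ m₀ → ∀ m → m₀ ≤ m → toℕ (proj₂ (walk m s) v) ≡ r

  EscapesBelow : List (Fin b) → State b → ℕ → Set
  EscapesBelow w s P = (∀ m → InSubtree w (proj₁ (walk m s)))
                     × (∀ u → Stabilises s (u ++ w) (rotorConfig P (reverse u)))

  kF : Fin b
  kF = fromℕ< k<b

  rotor-zero : rotor 0 ≡ k
  rotor-zero = trans (cong (_% D) (+-identityʳ k)) (m<n⇒m%n≡m (m<n⇒m<1+n k<b))

  rotorConfig-zero : ∀ v → rotorConfig 0 v ≡ k
  rotorConfig-zero []      = rotor-zero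
  rotorConfig-zero (i ∷ v) = trans (cong (λ n → rotorConfig (T n) v) (entries-zero i)) (rotorConfig-zero v)

  T-one : T 1 ≡ 1
  T-one = cong suc (nextTerminal-terminal 0 (inj₂ refl))

  private
    1<D : 1 < D
    1<D = s≤s (≤-trans (s≤s z≤n) 2≤b)

    offset-kF : offset kF ≡ 0
    offset-kF = trans (offset-≥ (≤-reflexive (sym (toℕ-fromℕ< k<b))))
                      (trans (cong (_∸ k) (toℕ-fromℕ< k<b)) (n∸n≡0 k))

    entries-one-kF : entries 1 kF ≡ 1
    entries-one-kF = trans (entries-> 1 kF (subst₂ _<_ (sym offset-kF) (sym (m<n⇒m%n≡m 1<D)) (s≤s z≤n)))
                           (cong suc (m<n⇒m/n≡0 1<D))

    entries-one-other : ∀ i → i ≢ kF → entries 1 i ≡ 0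
    entries-one-other i i≢kF = trans (entries-≤ 1 i offset≮1) (m<n⇒m/n≡0 1<D)
      where
      offset≮1 : ¬ offset i < 1 % D
      offset≮1 o<1 =
        i≢kF (offset-injective i kF (trans (n<1⇒n≡0 (subst (offset i <_) (m<n⇒m%n≡m 1<D) o<1)) (sym offset-kF)))

  rotorConfig-one-ks : ∀ n → rotorConfig 1 (replicate n kF) ≡ suc k
  rotorConfig-one-ks zero    = trans (cong (_% D) (+-comm k 1)) (m<n⇒m%n≡m (s≤s k<b))
  rotorConfig-one-ks (suc n) =
    trans (cong (λ m → rotorConfig (T m) (replicate n kF)) entries-one-kF)
          (trans (cong (λ P → rotorConfig P (replicate n kF)) T-one) (rotorConfig-one-ks n))

  rotorConfig-one-other : ∀ v → (∀ n → v ≢ replicate n kF) → rotorConfig 1 v ≡ k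
  rotorConfig-one-other []      v≢ks = ⊥-elim (v≢ks 0 refl)
  rotorConfig-one-other (i ∷ v) v≢ks with i Fin.≟ kF
  ... | yes refl = trans (cong (λ m → rotorConfig (T m) v) entries-one-kF)
                         (trans (cong (λ P → rotorConfig P v) T-one)
                                (rotorConfig-one-other v (λ n v≡ks → v≢ks (suc n) (cong (kF ∷_) v≡ks))))
  ... | no i≢kF  = trans (cong (λ m → rotorConfig (T m) v) (entries-one-other i i≢kF)) (rotorConfig-zero v)

  replicate-kF? : ∀ (u : List (Fin b)) → (∃ λ n → u ≡ replicate n kF) ⊎ (∀ n → u ≢ replicate n kF)
  replicate-kF? []      = inj₁ (0 , refl)
  replicate-kF? (i ∷ u) with i Fin.≟ kF | replicate-kF? u
  ... | yes refl | inj₁ (n , u≡) = inj₁ (suc n , cong (kF ∷_) u≡)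
  ... | yes refl | inj₂ u≢       = inj₂ λ { zero () ; (suc n) eq → u≢ n (∷-injectiveʳ eq) }
  ... | no  i≢kF | _             = inj₂ λ { zero () ; (suc n) eq → i≢kF (∷-injectiveˡ eq) }

  module FreshSubtree (w : List (Fin b)) (c : Config b) (agree : Agree c w 0) where

    start : State b
    start = node w , c

    path : ℕ → List (Fin b)
    path n = replicate n kF ++ w

    path-injective : ∀ {n n'} → path n ≡ path n' → n ≡ n'
    path-injective {n} {n'} eq = +-cancelʳ-≡ _ _ _ (trans (sym (length-path n)) (trans (cong length eq) (length-path n')))
      where
      length-path : ∀ n → length (path n) ≡ n + length w
      length-path n = trans (length-++ (replicate n kF)) (cong (_+ length w) (length-replicate n))

    -- A fresh rotor k is advanced to k + 1, that is towards child kF, so the particle runs down forever.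
    Invariant : ℕ → Set
    Invariant m = proj₁ (walk m start) ≡ node (path m)
                × (∀ n → n < m → toℕ (proj₂ (walk m start) (path n)) ≡ suc k)
                × (∀ v → (∀ n → n < m → v ≢ path n) → proj₂ (walk m start) v ≡ c v)

    invariant : ∀ m → Invariant m
    invariant zero    = refl , (λ _ ()) , (λ _ _ → refl)
    invariant (suc m) = at-path , passed , untouched
      where
      ih : Invariant m
      ih = invariant m
      cm : Config b
      cm = proj₂ (walk m start)
      toℕ-cm : toℕ (cm (path m)) ≡ k
      toℕ-cm = trans (cong toℕ (proj₂ (proj₂ ih) (path m) (λ n n<m eq → <-irrefl (sym (path-injective {m} {n} eq)) n<m)))
                     (trans (agree (replicate m kF)) (rotorConfig-zero (reverse (replicate m kF))))
      toℕ-next : toℕ (next (cm (path m))) ≡ suc k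
      toℕ-next = trans (toℕ-fromℕ< _) (trans (cong (λ n → suc n % D) toℕ-cm) (m<n⇒m%n≡m (s≤s k<b)))
      step≡ : walk (suc m) start ≡ (neighbour (path m) (next (cm (path m))) , update cm (path m) (next (cm (path m))))
      step≡ = step-node (walk m start) (path m) (proj₁ ih)
      at-path : proj₁ (walk (suc m) start) ≡ node (path (suc m))
      at-path = trans (cong proj₁ step≡)
                      (cong (neighbour (path m)) (toℕ-injective (trans toℕ-next (cong suc (sym (toℕ-fromℕ< k<b))))))
      cfg≡ : ∀ v → proj₂ (walk (suc m) start) v ≡ update cm (path m) (next (cm (path m))) v
      cfg≡ v = cong (λ s → proj₂ s v) step≡
      passed : ∀ n → n < suc m → toℕ (proj₂ (walk (suc m) start) (path n)) ≡ suc k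
      passed n n<1+m with n ≟ m
      ... | yes refl = trans (cong toℕ (trans (cfg≡ (path n)) (update-same cm (path n) _))) toℕ-next
      ... | no  n≢m  =
        trans (cong toℕ (trans (cfg≡ (path n)) (update-other cm (path m) _ (path n) (n≢m ∘ path-injective))))
              (proj₁ (proj₂ ih) n (≤∧≢⇒< (≤-pred n<1+m) n≢m))
      untouched : ∀ v → (∀ n → n < suc m → v ≢ path n) → proj₂ (walk (suc m) start) v ≡ c v
      untouched v v∉ = trans (cfg≡ v) (trans (update-other cm (path m) _ v (v∉ m ≤-refl))
                                             (proj₂ (proj₂ ih) v (λ n n<m → v∉ n (≤-trans n<m (n≤1+n m)))))

    escapes : EscapesBelow w start 1
    escapes = (λ m → subst (InSubtree w) (sym (proj₁ (invariant m))) (replicate m kF , refl)) , limit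
      where
      limit : ∀ u → Stabilises start (u ++ w) (rotorConfig 1 (reverse u))
      limit u with replicate-kF? u
      ... | inj₁ (n , refl) = suc n , λ m n<m →
        trans (proj₁ (proj₂ (invariant m)) n n<m)
              (sym (trans (cong (rotorConfig 1) (reverse-replicate n kF)) (rotorConfig-one-ks n)))
      ... | inj₂ u≢ks = 0 , λ m _ →
        trans (cong toℕ (proj₂ (proj₂ (invariant m)) (u ++ w) (λ n _ eq → u≢ks n (++-cancelʳ w u _ eq))))
              (trans (agree u) (trans (rotorConfig-zero (reverse u)) (sym (rotorConfig-one-other (reverse u) reverse-u≢ks))))
        where
        reverse-u≢ks : ∀ n → reverse u ≢ replicate n kF
        reverse-u≢ks n eq = u≢ks n (trans (sym (reverse-involutive u)) (trans (cong reverse eq) (reverse-replicate n kF)))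

  private
    ∸-<-+ : ∀ {m' m M} → m' < m + M → M ≤ m' → m' ∸ M < m
    ∸-<-+ {m'} {m} {M} m'<m+M M≤m' = subst (m' ∸ M <_) (m+n∸n≡m m M) (∸-monoˡ-< m'<m+M M≤m')

  ReturnsAt-prefix : ∀ {w} {s s' : State b} {P m} M → walk M s ≡ s' →
                     (∀ m' → m' < M → InSubtree w (proj₁ (walk m' s))) →
                     ReturnsAt w s' P m → ReturnsAt w s P (m + M)
  ReturnsAt-prefix {w} {s} {s'} {P} {m} M walk≡ inside (at-parent , inside' , agree) =
    trans (cong proj₁ walk-m+M) at-parent , inside-all , subst (λ s → Agree (proj₂ s) w P) (sym walk-m+M) agree
    where
    walk-m+M : walk (m + M) s ≡ walk m s'
    walk-m+M = trans (walk-+ m M s) (cong (walk m) walk≡)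
    inside-all : ∀ m' → m' < m + M → InSubtree w (proj₁ (walk m' s))
    inside-all m' m'<m+M with m' <? M
    ... | yes m'<M = inside m' m'<M
    ... | no  m'≮M = subst (InSubtree w ∘ proj₁) (sym (walk-from M walk≡ m' (≮⇒≥ m'≮M)))
                           (inside' (m' ∸ M) (∸-<-+ m'<m+M (≮⇒≥ m'≮M)))

  EscapesBelow-prefix : ∀ {w} {s s' : State b} {P} M → walk M s ≡ s' →
                        (∀ m' → m' < M → InSubtree w (proj₁ (walk m' s))) →
                        EscapesBelow w s' P → EscapesBelow w s P
  EscapesBelow-prefix {w} {s} {s'} {P} M walk≡ inside (inside' , limit) = inside-all , limit-all
    where
    inside-all : ∀ m' → InSubtree w (proj₁ (walk m' s))
    inside-all m' with m' <? M
    ... | yes m'<M = inside m' m'<M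
    ... | no  m'≮M = subst (InSubtree w ∘ proj₁) (sym (walk-from M walk≡ m' (≮⇒≥ m'≮M))) (inside' (m' ∸ M))
    limit-all : ∀ u → Stabilises s (u ++ w) (rotorConfig P (reverse u))
    limit-all u = proj₁ (limit u) + M , λ m m₀+M≤m →
      trans (cong (λ s → toℕ (proj₂ s (u ++ w))) (walk-from M walk≡ m (≤-trans (m≤n+m M _) m₀+M≤m)))
            (proj₂ (limit u) (m ∸ M) (subst (_≤ m ∸ M) (m+n∸n≡m (proj₁ (limit u)) M) (∸-monoˡ-≤ M m₀+M≤m)))

  module ChildVisit (w : List (Fin b)) (c : Config b) (P : ℕ) (i : Fin b) (agree : Agree c w P)
                    (next≡ : next (c w) ≡ Fin.suc i) (offset≡ : offset i ≡ P % D) where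

    start : State b
    start = node w , c

    c₁ : Config b
    c₁ = update c w (next (c w))

    entered : State b
    entered = node (i ∷ w) , c₁

    walk-suc-start : ∀ m → walk (suc m) start ≡ walk m entered
    walk-suc-start m = trans (walk-suc m start) (cong (λ r → walk m (neighbour w r , c₁)) next≡)

    c₁-top : toℕ (c₁ w) ≡ rotor (suc P)
    c₁-top = trans (cong toℕ (update-same c w _)) (toℕ-next-rotor P (c w) (agree []))

    c₁-below : ∀ u i' → c₁ (u ++ i' ∷ w) ≡ c (u ++ i' ∷ w)
    c₁-below u i' = update-below c w _ u i'

    entries-self : entries (suc P) i ≡ suc (P / D)
    entries-self = proj₂ (entries-suc-self P i offset≡)

    entries-sibling : ∀ i' → i' ≢ i → entries (suc P) i' ≡ entries P i'
    entries-sibling i' i'≢i = entries-suc-other P i' (λ eq → i'≢i (offset-injective i' i (trans eq (sym offset≡))))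

    entered-Agree : Agree c₁ (i ∷ w) (T (P / D))
    entered-Agree u = trans (cong toℕ (c₁-below u i))
      (trans (Agree-child {c} {w} {P} agree i u)
             (cong (λ n → rotorConfig (T n) (reverse u)) (proj₁ (entries-suc-self P i offset≡))))

    sibling-Agree : ∀ i' → i' ≢ i → Agree c (i' ∷ w) (T (entries (suc P) i'))
    sibling-Agree i' i'≢i u =
      trans (Agree-child {c} {w} {P} agree i' u) (cong (λ n → rotorConfig (T n) (reverse u)) (sym (entries-sibling i' i'≢i)))

    inside⇒≢top : ∀ {x} → InSubtree (i ∷ w) x → x ≢ node w
    inside⇒≢top inside refl = child-∉-own {i} {w} inside

    inside⇒≢sibling : ∀ {x} → InSubtree (i ∷ w) x → ∀ u i' → i' ≢ i → x ≢ node (u ++ i' ∷ w)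
    inside⇒≢sibling inside u i' i'≢i refl = sibling-∉ u i'≢i inside

    inside-before : ∀ {m} → (∀ m' → m' < m → InSubtree (i ∷ w) (proj₁ (walk m' entered))) →
                    ∀ m' → m' < suc m → InSubtree w (proj₁ (walk m' start))
    inside-before inside zero    _            = [] , refl
    inside-before inside (suc m') (s≤s m'<m) =
      subst (InSubtree w ∘ proj₁) (sym (walk-suc-start m')) (InSubtree-parent (inside m' m'<m))

    escapes-lift : EscapesBelow (i ∷ w) entered (T (suc (P / D))) → EscapesBelow w start (suc P)
    escapes-lift (inside , limit) = inside-all , limit-all
      where
      inside-all : ∀ m → InSubtree w (proj₁ (walk m start))
      inside-all m = inside-before (λ m' _ → inside m') m ≤-refl
      limit-all : ∀ u → Stabilises start (u ++ w) (rotorConfig (suc P) (reverse u))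
      limit-all u with reverseView u
      ... | [] = 1 , λ { (suc m) _ → trans (cong (λ s → toℕ (proj₂ s w)) (walk-suc-start m))
                           (trans (cong toℕ (walk-elsewhere m entered w (λ m' _ → inside⇒≢top (inside m')))) c₁-top) }
      ... | u' ∶ _ ∶ʳ i' = subst₂ (Stabilises start) (sym (++-assoc u' [ i' ] w))
                                  (cong (rotorConfig (suc P)) (sym (reverse-++ u' [ i' ]))) (below (i' Fin.≟ i))
        where
        below : Dec (i' ≡ i) → Stabilises start (u' ++ i' ∷ w) (rotorConfig (suc P) (i' ∷ reverse u'))
        below (yes refl) = suc (proj₁ (limit u')) , λ { (suc m) (s≤s m₀≤m) →
          trans (cong (λ s → toℕ (proj₂ s (u' ++ i ∷ w))) (walk-suc-start m))
                (trans (proj₂ (limit u') m m₀≤m) (cong (λ n → rotorConfig (T n) (reverse u')) (sym entries-self))) }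
        below (no i'≢i) = 0 , λ m _ →
          trans (cong toℕ (walk-elsewhere m start _ (never-there m))) (sibling-Agree i' i'≢i u')
          where
          never-there : ∀ m m' → m' < m → proj₁ (walk m' start) ≢ node (u' ++ i' ∷ w)
          never-there m zero     _ eq = below-≢ u' i' w (node-injective eq)
          never-there m (suc m') _ eq =
            inside⇒≢sibling (inside m') u' i' i'≢i (trans (sym (cong proj₁ (walk-suc-start m'))) eq)

    returns-lift : ∀ m → ReturnsAt (i ∷ w) entered (T (suc (P / D))) m →
                   proj₁ (walk (suc m) start) ≡ node w
                   × Agree (proj₂ (walk (suc m) start)) w (suc P)
                   × (∀ m' → m' < suc m → InSubtree w (proj₁ (walk m' start)))
    returns-lift m (at-top , inside , agree') =
      trans (cong proj₁ (walk-suc-start m)) at-top ,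
      subst (λ s → Agree (proj₂ s) w (suc P)) (sym (walk-suc-start m)) (Agree-intro {c₂} {w} {suc P} top below) ,
      inside-before inside
      where
      c₂ : Config b
      c₂ = proj₂ (walk m entered)
      top : toℕ (c₂ w) ≡ rotor (suc P)
      top = trans (cong toℕ (walk-elsewhere m entered w (λ m' m'<m → inside⇒≢top (inside m' m'<m)))) c₁-top
      below : ∀ i' → Agree c₂ (i' ∷ w) (T (entries (suc P) i'))
      below i' with i' Fin.≟ i
      ... | yes refl = subst (λ n → Agree c₂ (i ∷ w) (T n)) (sym entries-self) agree'
      ... | no  i'≢i = λ u →
        trans (cong toℕ (trans (walk-elsewhere m entered (u ++ i' ∷ w)
                                 (λ m' m'<m → inside⇒≢sibling (inside m' m'<m) u i' i'≢i))
                               (c₁-below u i')))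
              (sibling-Agree i' i'≢i u)

  Visit : ℕ → List (Fin b) → Config b → Set
  Visit j w c = ε j ≡ 0 × ∃ (ReturnsAt w (node w , c) (T (suc j)))
              ⊎ ε j ≡ 1 × EscapesBelow w (node w , c) (T (suc j))

  module Particle (j : ℕ) (ih : ∀ r → r < j → ∀ w c → Agree c w (T r) → Visit r w c) where

    child-visit : ∀ r → (1 ≤ r → r < j) → ∀ w c → Agree c w (T r) → Visit r w c
    child-visit zero    _   w c agree =
      inj₂ (refl , subst (EscapesBelow w (node w , c)) (sym T-one) (FreshSubtree.escapes w c agree))
    child-visit (suc r) r<j = ih (suc r) (r<j (s≤s z≤n))

    visit-from : ∀ n P → nextTerminal P ≡ n + P → nextTerminal P ≡ nextTerminal (T j) → outputs P ≡ applyUpTo ε j →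
                 ∀ w c → Agree c w P → Visit j w c
    visit-from n P _ nt≡ outputs≡ w c agree with departure P | terminal? P
    ... | toParent o≡bk rotor≡0 | _ =
      inj₁ (sym (output≡ε P j outputs≡ (departureOutput-parent _ o≡bk)) , 1 , at-parent , inside , agree₁)
      where
      at-parent : proj₁ (walk 1 (node w , c)) ≡ parentOf w
      at-parent = cong (neighbour w) (toℕ-injective (trans (toℕ-next-rotor P (c w) (agree [])) rotor≡0))
      inside : ∀ m' → m' < 1 → InSubtree w (proj₁ (walk m' (node w , c)))
      inside zero    _          = [] , refl
      inside (suc _) (s≤s ())
      c₁ : Config b
      c₁ = update c w (next (c w))
      agree₁ : Agree c₁ w (T (suc j))
      agree₁ = subst (Agree c₁ w) (cong suc (trans (sym (nextTerminal-terminal P (inj₁ o≡bk))) nt≡))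
        (Agree-intro {c₁} {w} {suc P}
          (trans (cong toℕ (update-same c w _)) (toℕ-next-rotor P (c w) (agree [])))
          (λ i' u → trans (cong toℕ (update-below c w _ u i'))
                      (trans (Agree-child {c} {w} {P} agree i' u)
                             (cong (λ n → rotorConfig (T n) (reverse u))
                                   (sym (entries-suc-other P i' (λ eq → offset≢bk i' (trans eq o≡bk))))))))
    ... | toChild i o≢bk rotor≡ offset≡ | yes term =
      inj₂ (sym (output≡ε P j outputs≡ (departureOutput-escape o≢bk e≡1)) , escapes)
      where
      open ChildVisit w c P i agree (toℕ-injective (trans (toℕ-next-rotor P (c w) (agree [])) rotor≡)) offset≡
      e≡1 : ε (P / D) ≡ 1
      e≡1 = Terminal⇒escape {P} term o≢bk
      escapes : EscapesBelow w start (T (suc j))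
      escapes with child-visit (P / D) (block<particles P j outputs≡) (i ∷ w) c₁ entered-Agree
      ... | inj₁ (e≡0 , _) = ⊥-elim (0≢1+n (trans (sym e≡0) e≡1))
      ... | inj₂ (_ , esc) = subst (EscapesBelow w start) (cong suc (trans (sym (nextTerminal-terminal P term)) nt≡))
                                   (escapes-lift esc)
    visit-from zero P nt≡n+P _ _ _ _ _ | toChild _ _ _ _ | no nonterm =
      ⊥-elim (<-irrefl (sym nt≡n+P) (nextTerminal-> P nonterm))
    visit-from (suc n) P nt≡n+P nt≡ outputs≡ w c agree | toChild i o≢bk rotor≡ offset≡ | no nonterm = continue
      where
      open ChildVisit w c P i agree (toℕ-injective (trans (toℕ-next-rotor P (c w) (agree [])) rotor≡)) offset≡
      continue : Visit j w c
      continue with child-visit (P / D) (block<particles P j outputs≡) (i ∷ w) c₁ entered-Agree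
      ... | inj₂ (e≡1 , _)          = ⊥-elim (nonterm (inj₂ e≡1))
      ... | inj₁ (_ , m₁ , returns) = shift (visit-from n (suc P) nt≡n+1+P nt≡' outputs≡' w c₂ (proj₁ (proj₂ back)))
        where
        c₂ : Config b
        c₂ = proj₂ (walk (suc m₁) start)
        back : proj₁ (walk (suc m₁) start) ≡ node w × Agree c₂ w (suc P)
               × (∀ m' → m' < suc m₁ → InSubtree w (proj₁ (walk m' start)))
        back = returns-lift m₁ returns
        walk≡ : walk (suc m₁) start ≡ (node w , c₂)
        walk≡ = cong (_, c₂) (proj₁ back)
        nt≡' : nextTerminal (suc P) ≡ nextTerminal (T j)
        nt≡' = trans (nextTerminal-suc P nonterm) nt≡
        nt≡n+1+P : nextTerminal (suc P) ≡ n + suc P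
        nt≡n+1+P = trans (nextTerminal-suc P nonterm) (trans nt≡n+P (sym (+-suc n P)))
        outputs≡' : outputs (suc P) ≡ applyUpTo ε j
        outputs≡' = trans (cong (outputs P ++_) (departureOutput-return o≢bk (nonterm ∘ inj₂)))
                          (trans (++-identityʳ _) outputs≡)
        shift : Visit j w c₂ → Visit j w c
        shift (inj₁ (e≡0 , m , ret)) = inj₁ (e≡0 , m + suc m₁ , ReturnsAt-prefix (suc m₁) walk≡ (proj₂ (proj₂ back)) ret)
        shift (inj₂ (e≡1 , esc))     = inj₂ (e≡1 , EscapesBelow-prefix (suc m₁) walk≡ (proj₂ (proj₂ back)) esc)

  visit : ∀ j w c → Agree c w (T j) → Visit j w c
  visit = <-rec (λ j → ∀ w c → Agree c w (T j) → Visit j w c) λ j ih →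
    Particle.visit-from j (λ r r<j → ih r<j) (nextTerminal (T j) ∸ T j) (T j)
      (sym (m∸n+n≡m (P≤nextTerminal (T j)))) refl (outputs-T j)

  configAfter : ℕ → Config b
  configAfter j v = fromℕ< (rotorConfig<D (T j) (reverse v))

  Agree-configAfter : ∀ j → Agree (configAfter j) [] (T j)
  Agree-configAfter j u = trans (toℕ-fromℕ< _) (cong (λ v → rotorConfig (T j) (reverse v)) (++-identityʳ u))

  configAfter-zero : configAfter 0 ≗ constCfg b k k<b
  configAfter-zero v = toℕ-injective (trans (toℕ-fromℕ< _) (trans (rotorConfig-zero (reverse v)) (sym (toℕ-fromℕ< _))))

  Agree⇒≗configAfter : ∀ (c : Config b) j → Agree c [] (T j) → c ≗ configAfter j
  Agree⇒≗configAfter c j agree v =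
    toℕ-injective (trans (cong (toℕ ∘ c) (sym (++-identityʳ v))) (trans (agree v) (sym (toℕ-fromℕ< _))))

  outcome : ∀ j → Outcome (configAfter j) (ε j) (configAfter (suc j))
  outcome j with visit j [] (configAfter j) (Agree-configAfter j)
  ... | inj₁ (e≡0 , m , at-root , inside , agree) = subst (λ e → Outcome (configAfter j) e (configAfter (suc j))) (sym e≡0)
    ( suc m , s≤s z≤n , trans (cong proj₁ (run-suc (configAfter j) m)) at-root
    , (λ { (suc m') _ (s≤s m'<m) eq → InSubtree⇒≢ρ (inside m' m'<m) (trans (sym (cong proj₁ (run-suc (configAfter j) m'))) eq) })
    , (λ v → trans (cong (λ s → proj₂ s v) (run-suc (configAfter j) m)) (Agree⇒≗configAfter _ (suc j) agree v)) )
  ... | inj₂ (e≡1 , inside , limit) = subst (λ e → Outcome (configAfter j) e (configAfter (suc j))) (sym e≡1)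
    ( (λ { (suc m') _ eq → InSubtree⇒≢ρ (inside m') (trans (sym (cong proj₁ (run-suc (configAfter j) m'))) eq) })
    , (λ v → suc (proj₁ (limit v)) , λ { (suc m) (s≤s m₀≤m) → toℕ-injective
        (trans (cong (λ s → toℕ (proj₂ s v)) (run-suc (configAfter j) m))
          (trans (cong (toℕ ∘ proj₂ (walk m (node [] , configAfter j))) (sym (++-identityʳ v)))
            (trans (proj₂ (limit v) m m₀≤m) (sym (toℕ-fromℕ< _))))) }) )

proposition17 : (b k : ℕ) .{{_ : NonZero b}} → 2 ≤ b → (k<b : k < b)
    → IsEscapeSeq (constCfg b k k<b) (escPattern b k)
    × (∀ e → IsEscapeSeq (constCfg b k k<b) e → ∀ n → e n ≡ escPattern b k n)
proposition17 b k 2≤b k<b = escapeSeq , λ e isEsc n → RotorWalk.escapeSeq-unique isEsc escapeSeq n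
  where
  open ConstantConfiguration b k 2≤b k<b
  escapeSeq : IsEscapeSeq (constCfg b k k<b) (escPattern b k)
  escapeSeq = configAfter , configAfter-zero , outcome
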